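{- As formal power series, \[ \sum_{n=0}^{\infty}\sum_{\pi\in\mathfrak{J}_{n}}t^{\operatorname{lrmin}(\pi)}\frac{x^{n}}{n!}=(\sec x+\tan x)^{t}. \]
   Context: A permutation of a finite set $S$ of positive integers is a word $\pi=\pi_1\cdots\pi_n$ ($n=|S|$) in which each element of $S$ appears exactly once; the empty word is the unique permutation of the empty set. $\mathfrak{S}_n$ denotes the set of permutations of $\{1,\dots,n\}$. For a permutation $\pi$ and a letter $x$ of $\pi$, let $\rho_\pi(x)$ be the maximal consecutive subword of $\pi$ consisting of the letters immediately to the right of $x$ that are all larger than $x$. A permutation $\pi$ is Jacobi if $|\rho_\pi(x)|$ is even for every letter $x$ of $\pi$. $\mathfrak{J}_n$ is the set of Jacobi permutations in $\mathfrak{S}_n$. A letter $\pi_k$ is a left-to-right minimum of $\pi$ if $\pi_k<\pi_i$ for all $i<k$; $\operatorname{lrmin}(\pi)$ is the number of left-to-right minima (so the empty permutation has $\operatorname{lrmin}=0$). -}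

module Defs where

open import Data.Nat as ℕ using (ℕ; zero; suc; _∸_; _<ᵇ_; _%_; _!)
open import Data.Nat.Properties using (_!≢0)
open import Data.Nat.Divisibility using (_∣_)
open import Data.Integer using (+_)
open import Data.Rational using (ℚ; 0ℚ; 1ℚ; _+_; _*_; -_; _/_)
open import Data.List using (List; []; _∷_; map; foldr; upTo)
open import Data.Bool using (if_then_else_)
open import Data.Product using (_×_)
open import Data.Unit using (⊤)
open import Data.List.Relation.Binary.Permutation.Propositional using (_↭_)
open import Relation.Binary.PropositionalEquality using (_≡_)

oneTo : ℕ → List ℕ
oneTo n = map suc (upTo n)

-- |ρ_π(x)| where xs is the suffix of π strictly to the right of x:
-- the length of the maximal run of letters immediately right of x that exceed x
rhoLen : ℕ → List ℕ → ℕ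
rhoLen x []       = 0
rhoLen x (y ∷ ys) = if x <ᵇ y then suc (rhoLen x ys) else 0

Jacobi : List ℕ → Set
Jacobi []       = ⊤
Jacobi (x ∷ xs) = (2 ∣ rhoLen x xs) × Jacobi xs

lrminFrom : ℕ → List ℕ → ℕ
lrminFrom m []       = 0
lrminFrom m (y ∷ ys) = if y <ᵇ m then suc (lrminFrom y ys) else lrminFrom m ys

lrmin : List ℕ → ℕ
lrmin []       = 0
lrmin (x ∷ xs) = suc (lrminFrom x xs)

JacobiLrmin : ℕ → ℕ → List ℕ → Set
JacobiLrmin n k π = (π ↭ oneTo n) × Jacobi π × (lrmin π ≡ k)

Series : Set
Series = ℕ → ℚ

sumℚ : List ℚ → ℚ
sumℚ = foldr _+_ 0ℚ

inv! : ℕ → ℚ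
inv! n = _/_ (+ 1) (n !) {{n !≢0}}

invSuc : ℕ → ℚ
invSuc j = + 1 / suc j

oneS : Series
oneS zero    = 1ℚ
oneS (suc _) = 0ℚ

_⊕_ : Series → Series → Series
(f ⊕ g) n = f n + g n

_⊖_ : Series → Series → Series
(f ⊖ g) n = f n + (- g n)

_⊛_ : Series → Series → Series
(f ⊛ g) n = sumℚ (map (λ i → f i * g (n ∸ i)) (upTo (suc n)))

_^S_ : Series → ℕ → Series
f ^S zero  = oneS
f ^S suc m = f ⊛ (f ^S m)

alt : ℕ → ℚ
alt zero    = 1ℚ
alt (suc k) = - alt k

cosS : Series
cosS n = if n % 2 ℕ.≡ᵇ 0 then alt (n ℕ./ 2) * inv! n else 0ℚ

sinS : Series
sinS n = if n % 2 ℕ.≡ᵇ 0 then 0ℚ else alt (n ℕ./ 2) * inv! n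

-- multiplicative inverse of a series A with A(0) = 1:
-- 1/A = Σ_{m ≥ 0} (1 - A)^m  (finite coefficientwise: only m ≤ n contribute to x^n)
invS : Series → Series
invS A n = sumℚ (map (λ m → ((oneS ⊖ A) ^S m) n) (upTo (suc n)))

-- logarithm of a series A with A(0) = 1:
-- log A = Σ_{m ≥ 1} (-1)^(m+1) (A - 1)^m / m
logS : Series → Series
logS A n = sumℚ (map (λ j → alt j * invSuc j * ((A ⊖ oneS) ^S suc j) n) (upTo n))

secS : Series
secS = invS cosS

tanS : Series
tanS = sinS ⊛ secS

-- A^t := exp(t log A) for A(0) = 1, a formal power series in x and t.
-- Coefficient of t^k x^n:  [x^n] (log A)^k / k!
powT : Series → ℕ → ℕ → ℚ
powT A k n = (logS A ^S k) n * inv! k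

secTanPowT : ℕ → ℕ → ℚ
secTanPowT k n = powT (secS ⊕ tanS) k n

{-# OPTIONS --safe #-}
module Submission where

-- Write a word on an alphabet with least letter m as π = σ m τ.  Every letter of τ exceeds m,
-- so ρ_π(m) = τ and the runs ρ_π(x) of the letters x of σ stop at m: π is Jacobi iff σ and τ
-- are Jacobi and |τ| is even, and lrmin π = 1 + lrmin σ.  Distributing the remaining letters
-- between σ and τ, the exponential generating functions A of all Jacobi permutations and T_k
-- of those with k left-to-right minima satisfy A′ = E·A and T_{k+1}′ = E·T_k, where E is the
-- even part of A, with A(0) = T_0(0) = 1.  The series sec + tan satisfies the same equation,
-- (sec + tan)′ = sec·(sec + tan) with sec even and tan odd; and the t^k-coefficient of
-- (sec + tan)^t = exp (t·log (sec + tan)) is (log (sec + tan))^k / k!, whose derivative is sec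
-- times the t^(k-1)-coefficient because (log (sec + tan))′ = sec.  Induction on n then matches
-- the counts of an explicit duplicate-free enumeration with n! times these coefficients.

open import Defs
open import Data.Nat as ℕ using (ℕ; zero; suc; _!; _≤_; _<_; _≥_; _<ᵇ_; z≤n; s≤s; NonZero; _%_)
import Data.Nat.Properties as ℕP
import Data.Nat.DivMod as ℕDM
open import Data.Nat.Divisibility using (_∣_; m%n≡0⇒n∣m; n∣m⇒m%n≡0)
import Data.Integer as ℤ
import Data.Integer.Properties as ℤP
open import Data.Rational using (ℚ; 0ℚ; 1ℚ; _+_; _*_; -_; _/_; toℚᵘ)
import Data.Rational.Properties as ℚP
import Data.Rational.Unnormalised as ℚᵘ
import Data.Rational.Unnormalised.Properties as ℚᵘP
open import Data.Rational.Solver using (module +-*-Solver)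
open import Data.Bool using (Bool; true; false; not; if_then_else_)
open import Data.Bool.Properties using (not-involutive; T-≡)
open import Data.Maybe using (Maybe; just; nothing)
open import Data.Product as Prod using (Σ; _×_; _,_; proj₁; proj₂)
open import Data.Sum using (inj₁; inj₂)
open import Data.Unit using (⊤; tt)
open import Data.List using (List; []; _∷_; _++_; map; upTo; applyUpTo; length; concatMap; filter)
import Data.List.Properties as LP
open import Data.List.Relation.Unary.All as All using (All; []; _∷_)
import Data.List.Relation.Unary.All.Properties as Allₚ
open import Data.List.Relation.Unary.Any using (here; there)
open import Data.List.Relation.Unary.AllPairs as AllPairs using (AllPairs; []; _∷_)
import Data.List.Relation.Unary.AllPairs.Properties as AllPairsₚ
open import Data.List.Relation.Unary.Unique.Propositional using (Unique)
import Data.List.Relation.Unary.Unique.Propositional.Properties as Unique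
open import Data.List.Membership.Propositional using (_∈_; _∉_; find; lose)
open import Data.List.Membership.Propositional.Properties using (∈-++⁺ˡ; ∈-++⁺ʳ; ∈-++⁻; ∈-map⁺; ∈-map⁻; ∈-∃++; ∈-concatMap⁺; ∈-concatMap⁻)
open import Data.List.Membership.DecPropositional ℕP._≟_ using (_∈?_)
open import Data.List.Relation.Binary.Permutation.Propositional using (_↭_; ↭-refl; ↭-sym; ↭-trans; prep)
open import Data.List.Relation.Binary.Permutation.Propositional.Properties using (∈-resp-↭; All-resp-↭; ↭-empty-inv; ↭-length; drop-mid; ++-comm; ++⁺) renaming (shift to ↭-shift)
open import Data.List.Relation.Ternary.Interleaving.Propositional using (Interleaving; []; consˡ; consʳ; toPermutation)
open import Data.List.Relation.Ternary.Interleaving.Properties using (interleave-length)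
open import Function using (_∘_)
open import Function.Bundles using (_⇔_; mk⇔; Equivalence)
open import Level using (0ℓ)
open import Relation.Nullary using (¬_; yes; no; contradiction)
open import Relation.Binary.Structures using (IsEquivalence)
import Relation.Binary.Reasoning.Setoid as SetoidReasoning
open import Relation.Binary.PropositionalEquality
open import Algebra.Bundles using (CommutativeRing)
open import Algebra.Structures using (IsCommutativeRing)
open import Algebra.Solver.Ring.AlmostCommutativeRing using (fromCommutativeRing; _-Raw-AlmostCommutative⟶_)
import Algebra.Solver.Ring

open +-*-Solver using (solve; _:=_; _:+_; _:*_; :-_; con)

fromℕ : ℕ → ℚ
fromℕ n = ℤ.+ n / 1

private
  toℚᵘ-fromℕ : ∀ n → toℚᵘ (fromℕ n) ℚᵘ.≃ ℚᵘ.mkℚᵘ (ℤ.+ n) 0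
  toℚᵘ-fromℕ n = ℚP.toℚᵘ-fromℚᵘ (ℚᵘ.mkℚᵘ (ℤ.+ n) 0)

fromℕ-+ : ∀ m n → fromℕ (m ℕ.+ n) ≡ fromℕ m + fromℕ n
fromℕ-+ m n = ℚP.toℚᵘ-injective (begin
  toℚᵘ (fromℕ (m ℕ.+ n))
    ≈⟨ toℚᵘ-fromℕ (m ℕ.+ n) ⟩
  ℚᵘ.mkℚᵘ (ℤ.+ (m ℕ.+ n)) 0
    ≈⟨ ℚᵘ.*≡* (cong (ℤ._* ℤ.+ 1) (sym (cong₂ ℤ._+_ (ℤP.*-identityʳ (ℤ.+ m)) (ℤP.*-identityʳ (ℤ.+ n))))) ⟩
  ℚᵘ.mkℚᵘ (ℤ.+ m) 0 ℚᵘ.+ ℚᵘ.mkℚᵘ (ℤ.+ n) 0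
    ≈⟨ ℚᵘP.+-cong (toℚᵘ-fromℕ m) (toℚᵘ-fromℕ n) ⟨
  toℚᵘ (fromℕ m) ℚᵘ.+ toℚᵘ (fromℕ n)
    ≈⟨ ℚP.toℚᵘ-homo-+ (fromℕ m) (fromℕ n) ⟨
  toℚᵘ (fromℕ m + fromℕ n) ∎)
  where open ℚᵘP.≃-Reasoning

fromℕ-* : ∀ m n → fromℕ (m ℕ.* n) ≡ fromℕ m * fromℕ n
fromℕ-* m n = ℚP.toℚᵘ-injective (begin
  toℚᵘ (fromℕ (m ℕ.* n))                    ≈⟨ toℚᵘ-fromℕ (m ℕ.* n) ⟩
  ℚᵘ.mkℚᵘ (ℤ.+ (m ℕ.* n)) 0                 ≈⟨ ℚᵘ.*≡* (cong (ℤ._* ℤ.+ 1) (ℤP.pos-* m n)) ⟩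
  ℚᵘ.mkℚᵘ (ℤ.+ m) 0 ℚᵘ.* ℚᵘ.mkℚᵘ (ℤ.+ n) 0  ≈⟨ ℚᵘP.*-cong (toℚᵘ-fromℕ m) (toℚᵘ-fromℕ n) ⟨
  toℚᵘ (fromℕ m) ℚᵘ.* toℚᵘ (fromℕ n)        ≈⟨ ℚP.toℚᵘ-homo-* (fromℕ m) (fromℕ n) ⟨
  toℚᵘ (fromℕ m * fromℕ n)                  ∎)
  where open ℚᵘP.≃-Reasoning

fromℕ-inverseˡ : ∀ n .{{_ : NonZero n}} → (ℤ.+ 1 / n) * fromℕ n ≡ 1ℚ
fromℕ-inverseˡ (suc n) = ℚP.toℚᵘ-injective (begin
  toℚᵘ ((ℤ.+ 1 / suc n) * fromℕ (suc n))          ≈⟨ ℚP.toℚᵘ-homo-* (ℤ.+ 1 / suc n) (fromℕ (suc n)) ⟩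
  toℚᵘ (ℤ.+ 1 / suc n) ℚᵘ.* toℚᵘ (fromℕ (suc n))  ≈⟨ ℚᵘP.*-cong (ℚP.toℚᵘ-fromℚᵘ (ℚᵘ.mkℚᵘ (ℤ.+ 1) n)) (toℚᵘ-fromℕ (suc n)) ⟩
  ℚᵘ.mkℚᵘ (ℤ.+ 1) n ℚᵘ.* ℚᵘ.mkℚᵘ (ℤ.+ suc n) 0    ≈⟨ ℚᵘ.*≡* (ℤP.*-assoc (ℤ.+ 1) (ℤ.+ suc n) (ℤ.+ 1)) ⟩
  toℚᵘ 1ℚ                                         ∎)
  where open ℚᵘP.≃-Reasoning

fromℕ!-inverseˡ : ∀ n → inv! n * fromℕ (n !) ≡ 1ℚ
fromℕ!-inverseˡ n = fromℕ-inverseˡ (n !) {{n ℕP.!≢0}}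

fromℕ-suc*inv!-suc : ∀ n → fromℕ (suc n) * inv! (suc n) ≡ inv! n
fromℕ-suc*inv!-suc n = begin
  fromℕ (suc n) * inv! (suc n)
    ≡⟨ ℚP.*-identityʳ _ ⟨
  fromℕ (suc n) * inv! (suc n) * 1ℚ
    ≡⟨ cong (fromℕ (suc n) * inv! (suc n) *_) (fromℕ!-inverseˡ n) ⟨
  fromℕ (suc n) * inv! (suc n) * (inv! n * fromℕ (n !))
    ≡⟨ solve 4 (λ a b c d → a :* b :* (c :* d) := b :* (a :* d) :* c) refl (fromℕ (suc n)) (inv! (suc n)) (inv! n) (fromℕ (n !)) ⟩
  inv! (suc n) * (fromℕ (suc n) * fromℕ (n !)) * inv! n
    ≡⟨ cong (λ x → inv! (suc n) * x * inv! n) (fromℕ-* (suc n) (n !)) ⟨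
  inv! (suc n) * fromℕ (suc n !) * inv! n
    ≡⟨ cong (_* inv! n) (fromℕ!-inverseˡ (suc n)) ⟩
  1ℚ * inv! n
    ≡⟨ ℚP.*-identityˡ (inv! n) ⟩
  inv! n ∎
  where open ≡-Reasoning

-- The ring of formal power series

infix 4 _≈_
_≈_ : Series → Series → Set
f ≈ g = ∀ n → f n ≡ g n

_≈[≤_]_ : Series → ℕ → Series → Set
f ≈[≤ n ] g = ∀ i → i ≤ n → f i ≡ g i

zeroS : Series
zeroS _ = 0ℚ

negS : Series → Series
negS f n = - f n

infixl 7 _·_
_·_ : ℚ → Series → Series
(c · f) n = c * f n

shift : Series → Series
shift f n = f (suc n)

≈-isEquivalence : IsEquivalence _≈_
≈-isEquivalence = record
  { refl  = λ _ → refl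
  ; sym   = λ f≈g n → sym (f≈g n)
  ; trans = λ f≈g g≈h n → trans (f≈g n) (g≈h n)
  }

open IsEquivalence ≈-isEquivalence using () renaming (refl to ≈-refl; sym to ≈-sym; trans to ≈-trans)

⊕-cong : ∀ {f f′ g g′} → f ≈ f′ → g ≈ g′ → f ⊕ g ≈ f′ ⊕ g′
⊕-cong f≈f′ g≈g′ n = cong₂ _+_ (f≈f′ n) (g≈g′ n)

⊕-congˡ : ∀ f {g g′} → g ≈ g′ → f ⊕ g ≈ f ⊕ g′
⊕-congˡ f g≈g′ n = cong (f n +_) (g≈g′ n)

⊕-congʳ : ∀ g {f f′} → f ≈ f′ → f ⊕ g ≈ f′ ⊕ g
⊕-congʳ g f≈f′ n = cong (_+ g n) (f≈f′ n)

⊖-congˡ : ∀ f {g g′} → g ≈ g′ → f ⊖ g ≈ f ⊖ g′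
⊖-congˡ f g≈g′ n = cong (λ x → f n + - x) (g≈g′ n)

⊛-0 : ∀ f g → (f ⊛ g) 0 ≡ f 0 * g 0
⊛-0 f g = ℚP.+-identityʳ (f 0 * g 0)

⊛-suc : ∀ f g n → (f ⊛ g) (suc n) ≡ f 0 * g (suc n) + (shift f ⊛ g) n
⊛-suc f g n = cong (λ s → f 0 * g (suc n) + sumℚ s)
  (trans (LP.map-applyUpTo suc (λ i → f i * g (suc n ℕ.∸ i)) (suc n))
         (sym (LP.map-upTo (λ i → f (suc i) * g (n ℕ.∸ i)) (suc n))))

⊛-cong-≤ : ∀ n {f f′ g g′} → f ≈[≤ n ] f′ → g ≈[≤ n ] g′ → (f ⊛ g) n ≡ (f′ ⊛ g′) n
⊛-cong-≤ zero {f} {f′} {g} {g′} f≈f′ g≈g′ = begin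
  (f ⊛ g) 0     ≡⟨ ⊛-0 f g ⟩
  f 0 * g 0     ≡⟨ cong₂ _*_ (f≈f′ 0 z≤n) (g≈g′ 0 z≤n) ⟩
  f′ 0 * g′ 0   ≡⟨ ⊛-0 f′ g′ ⟨
  (f′ ⊛ g′) 0   ∎
  where open ≡-Reasoning
⊛-cong-≤ (suc n) {f} {f′} {g} {g′} f≈f′ g≈g′ = begin
  (f ⊛ g) (suc n)
    ≡⟨ ⊛-suc f g n ⟩
  f 0 * g (suc n) + (shift f ⊛ g) n
    ≡⟨ cong₂ _+_ (cong₂ _*_ (f≈f′ 0 z≤n) (g≈g′ (suc n) ℕP.≤-refl))
                 (⊛-cong-≤ n (λ i i≤n → f≈f′ (suc i) (s≤s i≤n)) (λ i i≤n → g≈g′ i (ℕP.m≤n⇒m≤1+n i≤n))) ⟩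
  f′ 0 * g′ (suc n) + (shift f′ ⊛ g′) n
    ≡⟨ ⊛-suc f′ g′ n ⟨
  (f′ ⊛ g′) (suc n) ∎
  where open ≡-Reasoning

⊛-cong : ∀ {f f′ g g′} → f ≈ f′ → g ≈ g′ → f ⊛ g ≈ f′ ⊛ g′
⊛-cong f≈f′ g≈g′ n = ⊛-cong-≤ n (λ i _ → f≈f′ i) (λ i _ → g≈g′ i)

⊛-congˡ : ∀ f {g g′} → g ≈ g′ → f ⊛ g ≈ f ⊛ g′
⊛-congˡ f g≈g′ = ⊛-cong {f} (λ _ → refl) g≈g′

⊛-congʳ : ∀ g {f f′} → f ≈ f′ → f ⊛ g ≈ f′ ⊛ g
⊛-congʳ g f≈f′ = ⊛-cong {g = g} f≈f′ (λ _ → refl)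

⊛-zeroˡ : ∀ g → zeroS ⊛ g ≈ zeroS
⊛-zeroˡ g zero    = trans (⊛-0 zeroS g) (ℚP.*-zeroˡ (g 0))
⊛-zeroˡ g (suc n) = begin
  (zeroS ⊛ g) (suc n)                   ≡⟨ ⊛-suc zeroS g n ⟩
  0ℚ * g (suc n) + (zeroS ⊛ g) n        ≡⟨ cong₂ _+_ (ℚP.*-zeroˡ (g (suc n))) (⊛-zeroˡ g n) ⟩
  0ℚ + 0ℚ                               ≡⟨⟩
  0ℚ                                    ∎
  where open ≡-Reasoning

⊛-zeroʳ-≤ : ∀ n f {g} → g ≈[≤ n ] zeroS → (f ⊛ g) n ≡ 0ℚ
⊛-zeroʳ-≤ zero    f {g} g≈0 = trans (⊛-0 f g) (trans (cong (f 0 *_) (g≈0 0 z≤n)) (ℚP.*-zeroʳ (f 0)))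
⊛-zeroʳ-≤ (suc n) f {g} g≈0 = begin
  (f ⊛ g) (suc n)                       ≡⟨ ⊛-suc f g n ⟩
  f 0 * g (suc n) + (shift f ⊛ g) n     ≡⟨ cong₂ _+_ (trans (cong (f 0 *_) (g≈0 (suc n) ℕP.≤-refl)) (ℚP.*-zeroʳ (f 0)))
                                                     (⊛-zeroʳ-≤ n (shift f) (λ i i≤n → g≈0 i (ℕP.m≤n⇒m≤1+n i≤n))) ⟩
  0ℚ + 0ℚ                               ≡⟨⟩
  0ℚ                                    ∎
  where open ≡-Reasoning

⊛-identityˡ : ∀ g → oneS ⊛ g ≈ g
⊛-identityˡ g zero    = trans (⊛-0 oneS g) (ℚP.*-identityˡ (g 0))
⊛-identityˡ g (suc n) = begin
  (oneS ⊛ g) (suc n)                    ≡⟨ ⊛-suc oneS g n ⟩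
  1ℚ * g (suc n) + (zeroS ⊛ g) n        ≡⟨ cong₂ _+_ (ℚP.*-identityˡ (g (suc n))) (⊛-zeroˡ g n) ⟩
  g (suc n) + 0ℚ                        ≡⟨ ℚP.+-identityʳ (g (suc n)) ⟩
  g (suc n)                             ∎
  where open ≡-Reasoning

⊛-distribʳ : ∀ f g h → (f ⊕ g) ⊛ h ≈ (f ⊛ h) ⊕ (g ⊛ h)
⊛-distribʳ f g h zero = begin
  ((f ⊕ g) ⊛ h) 0              ≡⟨ ⊛-0 (f ⊕ g) h ⟩
  (f 0 + g 0) * h 0            ≡⟨ ℚP.*-distribʳ-+ (h 0) (f 0) (g 0) ⟩
  f 0 * h 0 + g 0 * h 0        ≡⟨ cong₂ _+_ (⊛-0 f h) (⊛-0 g h) ⟨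
  (f ⊛ h) 0 + (g ⊛ h) 0        ∎
  where open ≡-Reasoning
⊛-distribʳ f g h (suc n) = begin
  ((f ⊕ g) ⊛ h) (suc n)
    ≡⟨ ⊛-suc (f ⊕ g) h n ⟩
  (f 0 + g 0) * h (suc n) + ((shift f ⊕ shift g) ⊛ h) n
    ≡⟨ cong ((f 0 + g 0) * h (suc n) +_) (⊛-distribʳ (shift f) (shift g) h n) ⟩
  (f 0 + g 0) * h (suc n) + ((shift f ⊛ h) n + (shift g ⊛ h) n)
    ≡⟨ solve 5 (λ a b c x y → (a :+ b) :* c :+ (x :+ y) := (a :* c :+ x) :+ (b :* c :+ y)) refl
         (f 0) (g 0) (h (suc n)) ((shift f ⊛ h) n) ((shift g ⊛ h) n) ⟩
  (f 0 * h (suc n) + (shift f ⊛ h) n) + (g 0 * h (suc n) + (shift g ⊛ h) n)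
    ≡⟨ cong₂ _+_ (⊛-suc f h n) (⊛-suc g h n) ⟨
  (f ⊛ h) (suc n) + (g ⊛ h) (suc n)
    ∎
  where open ≡-Reasoning

⊛-comm : ∀ f g → f ⊛ g ≈ g ⊛ f
⊛-comm f g zero = begin
  (f ⊛ g) 0    ≡⟨ ⊛-0 f g ⟩
  f 0 * g 0    ≡⟨ ℚP.*-comm (f 0) (g 0) ⟩
  g 0 * f 0    ≡⟨ ⊛-0 g f ⟨
  (g ⊛ f) 0    ∎
  where open ≡-Reasoning
⊛-comm f g (suc zero) = begin
  (f ⊛ g) 1                     ≡⟨ ⊛-suc f g 0 ⟩
  f 0 * g 1 + (shift f ⊛ g) 0   ≡⟨ cong (f 0 * g 1 +_) (⊛-0 (shift f) g) ⟩
  f 0 * g 1 + f 1 * g 0         ≡⟨ solve 4 (λ a b c d → a :* b :+ c :* d := d :* c :+ b :* a) refl (f 0) (g 1) (f 1) (g 0) ⟩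
  g 0 * f 1 + g 1 * f 0         ≡⟨ cong (g 0 * f 1 +_) (⊛-0 (shift g) f) ⟨
  g 0 * f 1 + (shift g ⊛ f) 0   ≡⟨ ⊛-suc g f 0 ⟨
  (g ⊛ f) 1                     ∎
  where open ≡-Reasoning
⊛-comm f g (suc (suc n)) = begin
  (f ⊛ g) (2 ℕ.+ n)
    ≡⟨ ⊛-suc f g (suc n) ⟩
  f 0 * g (2 ℕ.+ n) + (shift f ⊛ g) (suc n)
    ≡⟨ cong (f 0 * g (2 ℕ.+ n) +_) (trans (⊛-comm (shift f) g (suc n)) (⊛-suc g (shift f) n)) ⟩
  f 0 * g (2 ℕ.+ n) + (g 0 * f (2 ℕ.+ n) + (shift g ⊛ shift f) n)
    ≡⟨ cong (λ x → f 0 * g (2 ℕ.+ n) + (g 0 * f (2 ℕ.+ n) + x)) (⊛-comm (shift g) (shift f) n) ⟩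
  f 0 * g (2 ℕ.+ n) + (g 0 * f (2 ℕ.+ n) + (shift f ⊛ shift g) n)
    ≡⟨ solve 3 (λ a b x → a :+ (b :+ x) := b :+ (a :+ x)) refl (f 0 * g (2 ℕ.+ n)) (g 0 * f (2 ℕ.+ n)) ((shift f ⊛ shift g) n) ⟩
  g 0 * f (2 ℕ.+ n) + (f 0 * g (2 ℕ.+ n) + (shift f ⊛ shift g) n)
    ≡⟨ cong (g 0 * f (2 ℕ.+ n) +_) (trans (⊛-comm (shift g) f (suc n)) (⊛-suc f (shift g) n)) ⟨
  g 0 * f (2 ℕ.+ n) + (shift g ⊛ f) (suc n)
    ≡⟨ ⊛-suc g f (suc n) ⟨
  (g ⊛ f) (2 ℕ.+ n)
    ∎
  where open ≡-Reasoning

⊛-identityʳ : ∀ f → f ⊛ oneS ≈ f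
⊛-identityʳ f = ≈-trans (⊛-comm f oneS) (⊛-identityˡ f)

⊛-distribˡ : ∀ f g h → f ⊛ (g ⊕ h) ≈ (f ⊛ g) ⊕ (f ⊛ h)
⊛-distribˡ f g h n = begin
  (f ⊛ (g ⊕ h)) n            ≡⟨ ⊛-comm f (g ⊕ h) n ⟩
  ((g ⊕ h) ⊛ f) n            ≡⟨ ⊛-distribʳ g h f n ⟩
  (g ⊛ f) n + (h ⊛ f) n      ≡⟨ cong₂ _+_ (⊛-comm g f n) (⊛-comm h f n) ⟩
  (f ⊛ g) n + (f ⊛ h) n      ∎
  where open ≡-Reasoning

·-⊛-assoc : ∀ c f g → (c · f) ⊛ g ≈ c · (f ⊛ g)
·-⊛-assoc c f g zero = begin
  ((c · f) ⊛ g) 0       ≡⟨ ⊛-0 (c · f) g ⟩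
  c * f 0 * g 0         ≡⟨ ℚP.*-assoc c (f 0) (g 0) ⟩
  c * (f 0 * g 0)       ≡⟨ cong (c *_) (⊛-0 f g) ⟨
  c * (f ⊛ g) 0         ∎
  where open ≡-Reasoning
·-⊛-assoc c f g (suc n) = begin
  ((c · f) ⊛ g) (suc n)
    ≡⟨ ⊛-suc (c · f) g n ⟩
  c * f 0 * g (suc n) + ((c · shift f) ⊛ g) n
    ≡⟨ cong (c * f 0 * g (suc n) +_) (·-⊛-assoc c (shift f) g n) ⟩
  c * f 0 * g (suc n) + c * (shift f ⊛ g) n
    ≡⟨ solve 4 (λ c a b x → c :* a :* b :+ c :* x := c :* (a :* b :+ x)) refl c (f 0) (g (suc n)) ((shift f ⊛ g) n) ⟩
  c * (f 0 * g (suc n) + (shift f ⊛ g) n)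
    ≡⟨ cong (c *_) (⊛-suc f g n) ⟨
  c * (f ⊛ g) (suc n) ∎
  where open ≡-Reasoning

shift-⊛ : ∀ f g → shift (f ⊛ g) ≈ (shift f ⊛ g) ⊕ (f 0 · shift g)
shift-⊛ f g n = trans (⊛-suc f g n) (ℚP.+-comm (f 0 * g (suc n)) ((shift f ⊛ g) n))

⊛-assoc : ∀ f g h → (f ⊛ g) ⊛ h ≈ f ⊛ (g ⊛ h)
⊛-assoc f g h zero = begin
  ((f ⊛ g) ⊛ h) 0       ≡⟨ ⊛-0 (f ⊛ g) h ⟩
  (f ⊛ g) 0 * h 0       ≡⟨ cong (_* h 0) (⊛-0 f g) ⟩
  f 0 * g 0 * h 0       ≡⟨ ℚP.*-assoc (f 0) (g 0) (h 0) ⟩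
  f 0 * (g 0 * h 0)     ≡⟨ cong (f 0 *_) (⊛-0 g h) ⟨
  f 0 * (g ⊛ h) 0       ≡⟨ ⊛-0 f (g ⊛ h) ⟨
  (f ⊛ (g ⊛ h)) 0       ∎
  where open ≡-Reasoning
⊛-assoc f g h (suc n) = begin
  ((f ⊛ g) ⊛ h) (suc n)
    ≡⟨ ⊛-suc (f ⊛ g) h n ⟩
  (f ⊛ g) 0 * h (suc n) + (shift (f ⊛ g) ⊛ h) n
    ≡⟨ cong₂ (λ a b → a * h (suc n) + b) (⊛-0 f g) (⊛-congʳ h (shift-⊛ f g) n) ⟩
  f 0 * g 0 * h (suc n) + (((shift f ⊛ g) ⊕ (f 0 · shift g)) ⊛ h) n
    ≡⟨ cong (f 0 * g 0 * h (suc n) +_) (⊛-distribʳ (shift f ⊛ g) (f 0 · shift g) h n) ⟩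
  f 0 * g 0 * h (suc n) + (((shift f ⊛ g) ⊛ h) n + ((f 0 · shift g) ⊛ h) n)
    ≡⟨ cong₂ (λ a b → f 0 * g 0 * h (suc n) + (a + b)) (⊛-assoc (shift f) g h n) (·-⊛-assoc (f 0) (shift g) h n) ⟩
  f 0 * g 0 * h (suc n) + ((shift f ⊛ (g ⊛ h)) n + f 0 * (shift g ⊛ h) n)
    ≡⟨ solve 5 (λ a b c y x → a :* b :* c :+ (y :+ a :* x) := a :* (b :* c :+ x) :+ y) refl
         (f 0) (g 0) (h (suc n)) ((shift f ⊛ (g ⊛ h)) n) ((shift g ⊛ h) n) ⟩
  f 0 * (g 0 * h (suc n) + (shift g ⊛ h) n) + (shift f ⊛ (g ⊛ h)) n
    ≡⟨ cong (λ x → f 0 * x + (shift f ⊛ (g ⊛ h)) n) (⊛-suc g h n) ⟨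
  f 0 * (g ⊛ h) (suc n) + (shift f ⊛ (g ⊛ h)) n
    ≡⟨ ⊛-suc f (g ⊛ h) n ⟨
  (f ⊛ (g ⊛ h)) (suc n)
    ∎
  where open ≡-Reasoning

seriesIsCommutativeRing : IsCommutativeRing _≈_ _⊕_ _⊛_ negS zeroS oneS
seriesIsCommutativeRing = record
  { isRing = record
    { +-isAbelianGroup = record
      { isGroup = record
        { isMonoid = record
          { isSemigroup = record
            { isMagma = record { isEquivalence = ≈-isEquivalence ; ∙-cong = ⊕-cong }
            ; assoc = λ f g h n → ℚP.+-assoc (f n) (g n) (h n) }
          ; identity = (λ f n → ℚP.+-identityˡ (f n)) , (λ f n → ℚP.+-identityʳ (f n)) }
        ; inverse = (λ f n → ℚP.+-inverseˡ (f n)) , (λ f n → ℚP.+-inverseʳ (f n))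
        ; ⁻¹-cong = λ f≈g n → cong -_ (f≈g n) }
      ; comm = λ f g n → ℚP.+-comm (f n) (g n) }
    ; *-cong = ⊛-cong
    ; *-assoc = ⊛-assoc
    ; *-identity = ⊛-identityˡ , ⊛-identityʳ
    ; distrib = ⊛-distribˡ , (λ f g h → ⊛-distribʳ g h f) }
  ; *-comm = ⊛-comm
  }

seriesRing : CommutativeRing 0ℓ 0ℓ
seriesRing = record { isCommutativeRing = seriesIsCommutativeRing }

module ≈-Reasoning = SetoidReasoning (CommutativeRing.setoid seriesRing)

constS : ℚ → Series
constS c = c · oneS

·-constS : ∀ c f → c · f ≈ constS c ⊛ f
·-constS c f n = sym (trans (·-⊛-assoc c oneS f n) (cong (c *_) (⊛-identityˡ f n)))

constS-morphism : CommutativeRing.rawRing ℚP.+-*-commutativeRing -Raw-AlmostCommutative⟶ fromCommutativeRing seriesRing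
constS-morphism = record
  { ⟦_⟧    = constS
  ; +-homo = λ a b n → ℚP.*-distribʳ-+ (oneS n) a b
  ; *-homo = λ a b n → trans (ℚP.*-assoc a b (oneS n)) (·-constS a (constS b) n)
  ; -‿homo = λ a n → sym (ℚP.neg-distribˡ-* a (oneS n))
  ; 0-homo = λ n → ℚP.*-zeroˡ (oneS n)
  ; 1-homo = λ n → ℚP.*-identityˡ (oneS n)
  }

-- The ring solver reads the constant 1 as constS 1ℚ, which equals oneS only propositionally.
oneS≈constS1 : oneS ≈ constS 1ℚ
oneS≈constS1 n = sym (ℚP.*-identityˡ (oneS n))

constS-≟ : ∀ a b → Maybe (constS a ≈ constS b)
constS-≟ a b with a ℚP.≟ b
... | yes a≡b = just (λ n → cong (_* oneS n) a≡b)
... | no _    = nothing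

module SeriesSolver = Algebra.Solver.Ring (CommutativeRing.rawRing ℚP.+-*-commutativeRing)
  (fromCommutativeRing seriesRing) constS-morphism constS-≟

open SeriesSolver using ()
  renaming (solve to solveS; _:+_ to _:⊕_; _:*_ to _:⊛_; :-_ to :⊝_; _:-_ to _:⊖_; _:=_ to _:≈_; con to conS)

-- Finite sums and derivatives

sumℚ-applyUpTo-suc : ∀ (h : ℕ → ℚ) N → sumℚ (applyUpTo h (suc N)) ≡ sumℚ (applyUpTo h N) + h N
sumℚ-applyUpTo-suc h zero    = ℚP.+-comm (h 0) 0ℚ
sumℚ-applyUpTo-suc h (suc N) = trans (cong (h 0 +_) (sumℚ-applyUpTo-suc (λ i → h (suc i)) N))
                                     (sym (ℚP.+-assoc (h 0) (sumℚ (applyUpTo (λ i → h (suc i)) N)) (h (suc N))))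

sumℚ-++ : ∀ xs ys → sumℚ (xs ++ ys) ≡ sumℚ xs + sumℚ ys
sumℚ-++ []       ys = sym (ℚP.+-identityˡ (sumℚ ys))
sumℚ-++ (x ∷ xs) ys = trans (cong (x +_) (sumℚ-++ xs ys)) (sym (ℚP.+-assoc x (sumℚ xs) (sumℚ ys)))

sumℚ-map-+ : ∀ {A : Set} (a b : A → ℚ) xs → sumℚ (map (λ x → a x + b x) xs) ≡ sumℚ (map a xs) + sumℚ (map b xs)
sumℚ-map-+ a b []       = refl
sumℚ-map-+ a b (x ∷ xs) = begin
  a x + b x + sumℚ (map (λ x → a x + b x) xs)
    ≡⟨ cong (a x + b x +_) (sumℚ-map-+ a b xs) ⟩
  a x + b x + (sumℚ (map a xs) + sumℚ (map b xs))
    ≡⟨ solve 4 (λ p q r s → p :+ q :+ (r :+ s) := p :+ r :+ (q :+ s)) refl (a x) (b x) (sumℚ (map a xs)) (sumℚ (map b xs)) ⟩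
  a x + sumℚ (map a xs) + (b x + sumℚ (map b xs)) ∎
  where open ≡-Reasoning

*-sumℚ : ∀ {A : Set} c (a : A → ℚ) xs → c * sumℚ (map a xs) ≡ sumℚ (map (λ x → c * a x) xs)
*-sumℚ c a []       = ℚP.*-zeroʳ c
*-sumℚ c a (x ∷ xs) = trans (ℚP.*-distribˡ-+ c (a x) (sumℚ (map a xs))) (cong (c * a x +_) (*-sumℚ c a xs))

∂ : Series → Series
∂ f n = fromℕ (suc n) * f (suc n)

∂-cong : ∀ {f g} → f ≈ g → ∂ f ≈ ∂ g
∂-cong f≈g n = cong (fromℕ (suc n) *_) (f≈g (suc n))

∂-⊕ : ∀ f g → ∂ (f ⊕ g) ≈ ∂ f ⊕ ∂ g
∂-⊕ f g n = ℚP.*-distribˡ-+ (fromℕ (suc n)) (f (suc n)) (g (suc n))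

∂-· : ∀ c f → ∂ (c · f) ≈ c · ∂ f
∂-· c f n = solve 3 (λ a c x → a :* (c :* x) := c :* (a :* x)) refl (fromℕ (suc n)) c (f (suc n))

∂-oneS : ∂ oneS ≈ zeroS
∂-oneS n = ℚP.*-zeroʳ (fromℕ (suc n))

-- The Euler operator x·∂, with ∂ f n = x∂ f (suc n); it obeys Leibniz because n = i + (n ∸ i).
x∂ : Series → Series
x∂ f n = fromℕ n * f n

x∂-⊛ : ∀ f g → x∂ (f ⊛ g) ≈ (x∂ f ⊛ g) ⊕ (f ⊛ x∂ g)
x∂-⊛ f g n = begin
  fromℕ n * sumℚ (map (λ i → f i * g (n ℕ.∸ i)) (upTo (suc n)))
    ≡⟨ *-sumℚ (fromℕ n) (λ i → f i * g (n ℕ.∸ i)) (upTo (suc n)) ⟩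
  sumℚ (map (λ i → fromℕ n * (f i * g (n ℕ.∸ i))) (upTo (suc n)))
    ≡⟨ cong sumℚ (LP.map-cong-local (All.map split-weight (Allₚ.all-upTo (suc n)))) ⟩
  sumℚ (map (λ i → x∂ f i * g (n ℕ.∸ i) + f i * x∂ g (n ℕ.∸ i)) (upTo (suc n)))
    ≡⟨ sumℚ-map-+ (λ i → x∂ f i * g (n ℕ.∸ i)) (λ i → f i * x∂ g (n ℕ.∸ i)) (upTo (suc n)) ⟩
  (x∂ f ⊛ g) n + (f ⊛ x∂ g) n
    ∎
  where
  open ≡-Reasoning
  split-weight : ∀ {i} → i < suc n → fromℕ n * (f i * g (n ℕ.∸ i)) ≡ x∂ f i * g (n ℕ.∸ i) + f i * x∂ g (n ℕ.∸ i)
  split-weight {i} i<1+n = begin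
    fromℕ n * (f i * g (n ℕ.∸ i))
      ≡⟨ cong (λ k → fromℕ k * (f i * g (n ℕ.∸ i))) (ℕP.m+[n∸m]≡n (ℕP.≤-pred i<1+n)) ⟨
    fromℕ (i ℕ.+ (n ℕ.∸ i)) * (f i * g (n ℕ.∸ i))
      ≡⟨ cong (_* (f i * g (n ℕ.∸ i))) (fromℕ-+ i (n ℕ.∸ i)) ⟩
    (fromℕ i + fromℕ (n ℕ.∸ i)) * (f i * g (n ℕ.∸ i))
      ≡⟨ solve 4 (λ a b x y → (a :+ b) :* (x :* y) := a :* x :* y :+ x :* (b :* y)) refl (fromℕ i) (fromℕ (n ℕ.∸ i)) (f i) (g (n ℕ.∸ i)) ⟩
    x∂ f i * g (n ℕ.∸ i) + f i * x∂ g (n ℕ.∸ i) ∎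

x∂-⊛-suc : ∀ f g n → (x∂ f ⊛ g) (suc n) ≡ (∂ f ⊛ g) n
x∂-⊛-suc f g n = begin
  (x∂ f ⊛ g) (suc n)
    ≡⟨ ⊛-suc (x∂ f) g n ⟩
  0ℚ * f 0 * g (suc n) + (∂ f ⊛ g) n
    ≡⟨ cong (_+ (∂ f ⊛ g) n) (trans (cong (_* g (suc n)) (ℚP.*-zeroˡ (f 0))) (ℚP.*-zeroˡ (g (suc n)))) ⟩
  0ℚ + (∂ f ⊛ g) n
    ≡⟨ ℚP.+-identityˡ ((∂ f ⊛ g) n) ⟩
  (∂ f ⊛ g) n ∎
  where open ≡-Reasoning

∂-⊛ : ∀ f g → ∂ (f ⊛ g) ≈ (∂ f ⊛ g) ⊕ (f ⊛ ∂ g)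
∂-⊛ f g n = begin
  x∂ (f ⊛ g) (suc n)                            ≡⟨ x∂-⊛ f g (suc n) ⟩
  (x∂ f ⊛ g) (suc n) + (f ⊛ x∂ g) (suc n)       ≡⟨ cong ((x∂ f ⊛ g) (suc n) +_) (⊛-comm f (x∂ g) (suc n)) ⟩
  (x∂ f ⊛ g) (suc n) + (x∂ g ⊛ f) (suc n)       ≡⟨ cong₂ _+_ (x∂-⊛-suc f g n) (x∂-⊛-suc g f n) ⟩
  (∂ f ⊛ g) n + (∂ g ⊛ f) n                     ≡⟨ cong ((∂ f ⊛ g) n +_) (⊛-comm (∂ g) f n) ⟩
  (∂ f ⊛ g) n + (f ⊛ ∂ g) n                     ∎
  where open ≡-Reasoning

∂-^ : ∀ k f → ∂ (f ^S suc k) ≈ fromℕ (suc k) · ((f ^S k) ⊛ ∂ f)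
∂-^ zero f n = begin
  ∂ (f ⊛ oneS) n         ≡⟨ ∂-cong (λ i → trans (⊛-comm f oneS i) (⊛-identityˡ f i)) n ⟩
  ∂ f n                  ≡⟨ ⊛-identityˡ (∂ f) n ⟨
  (oneS ⊛ ∂ f) n         ≡⟨ ℚP.*-identityˡ _ ⟨
  1ℚ * (oneS ⊛ ∂ f) n    ∎
  where open ≡-Reasoning
∂-^ (suc k) f = begin
  ∂ (f ⊛ (f ^S suc k))
    ≈⟨ ∂-⊛ f (f ^S suc k) ⟩
  (∂ f ⊛ (f ^S suc k)) ⊕ (f ⊛ ∂ (f ^S suc k))
    ≈⟨ ⊕-congˡ (∂ f ⊛ (f ^S suc k)) (⊛-congˡ f (≈-trans (∂-^ k f) (·-constS c ((f ^S k) ⊛ ∂ f)))) ⟩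
  (∂ f ⊛ (f ⊛ (f ^S k))) ⊕ (f ⊛ (constS c ⊛ ((f ^S k) ⊛ ∂ f)))
    ≈⟨ solveS 4 (λ df x xk c → (df :⊛ (x :⊛ xk)) :⊕ (x :⊛ (c :⊛ (xk :⊛ df))) :≈ ((x :⊛ xk) :⊛ df) :⊕ (c :⊛ ((x :⊛ xk) :⊛ df))) (λ _ → refl) (∂ f) f (f ^S k) (constS c) ⟩
  ((f ^S suc k) ⊛ ∂ f) ⊕ (constS c ⊛ ((f ^S suc k) ⊛ ∂ f))
    ≈⟨ ⊕-congˡ ((f ^S suc k) ⊛ ∂ f) (≈-sym (·-constS c ((f ^S suc k) ⊛ ∂ f))) ⟩
  ((f ^S suc k) ⊛ ∂ f) ⊕ (c · ((f ^S suc k) ⊛ ∂ f))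
    ≈⟨ (λ n → solve 2 (λ c x → x :+ c :* x := (con 1ℚ :+ c) :* x) refl c (((f ^S suc k) ⊛ ∂ f) n)) ⟩
  (1ℚ + c) · ((f ^S suc k) ⊛ ∂ f)
    ≈⟨ (λ n → cong (_* ((f ^S suc k) ⊛ ∂ f) n) (fromℕ-+ 1 (suc k))) ⟨
  fromℕ (2 ℕ.+ k) · ((f ^S suc k) ⊛ ∂ f) ∎
  where
  open ≈-Reasoning
  c = fromℕ (suc k)

∂≈0⇒constant : ∀ f → ∂ f ≈ zeroS → f ≈ constS (f 0)
∂≈0⇒constant f ∂f≈0 zero    = sym (ℚP.*-identityʳ (f 0))
∂≈0⇒constant f ∂f≈0 (suc n) = begin
  f (suc n)                                   ≡⟨ ℚP.*-identityˡ (f (suc n)) ⟨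
  1ℚ * f (suc n)                              ≡⟨ cong (_* f (suc n)) (fromℕ-inverseˡ (suc n)) ⟨
  invSuc n * fromℕ (suc n) * f (suc n)        ≡⟨ ℚP.*-assoc (invSuc n) (fromℕ (suc n)) (f (suc n)) ⟩
  invSuc n * ∂ f n                            ≡⟨ cong (invSuc n *_) (∂f≈0 n) ⟩
  invSuc n * 0ℚ                               ≡⟨ ℚP.*-zeroʳ (invSuc n) ⟩
  0ℚ                                          ≡⟨ ℚP.*-zeroʳ (f 0) ⟨
  f 0 * 0ℚ                                    ∎
  where open ≡-Reasoning

-- Inverse and logarithm

seriesSum : ℕ → (ℕ → Series) → Series
seriesSum zero    F = zeroS
seriesSum (suc N) F = seriesSum N F ⊕ F N

seriesSum-coeff : ∀ N F n → seriesSum N F n ≡ sumℚ (map (λ m → F m n) (upTo N))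
seriesSum-coeff zero    F n = refl
seriesSum-coeff (suc N) F n = begin
  seriesSum N F n + F N n                               ≡⟨ cong (_+ F N n) (seriesSum-coeff N F n) ⟩
  sumℚ (map (λ m → F m n) (upTo N)) + F N n             ≡⟨ cong (_+ F N n) (cong sumℚ (LP.map-upTo (λ m → F m n) N)) ⟩
  sumℚ (applyUpTo (λ m → F m n) N) + F N n              ≡⟨ sumℚ-applyUpTo-suc (λ m → F m n) N ⟨
  sumℚ (applyUpTo (λ m → F m n) (suc N))                ≡⟨ cong sumℚ (LP.map-upTo (λ m → F m n) (suc N)) ⟨
  sumℚ (map (λ m → F m n) (upTo (suc N)))               ∎
  where open ≡-Reasoning

seriesSum-stable : ∀ F n → (∀ m → n < m → F m n ≡ 0ℚ) → ∀ N → suc n ≤ N → seriesSum N F n ≡ seriesSum (suc n) F n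
seriesSum-stable F n F≡0 (suc N) (s≤s n≤N) with ℕP.m≤n⇒m<n∨m≡n n≤N
... | inj₁ n<N  = trans (cong₂ _+_ (seriesSum-stable F n F≡0 N n<N) (F≡0 N n<N)) (ℚP.+-identityʳ _)
... | inj₂ refl = refl

^S-vanishes-below : ∀ f → f 0 ≡ 0ℚ → ∀ m n → n < m → (f ^S m) n ≡ 0ℚ
^S-vanishes-below f f₀≡0 (suc m) zero    _         =
  trans (⊛-0 f (f ^S m)) (trans (cong (_* (f ^S m) 0) f₀≡0) (ℚP.*-zeroˡ ((f ^S m) 0)))
^S-vanishes-below f f₀≡0 (suc m) (suc n) (s≤s n<m) = begin
  (f ⊛ (f ^S m)) (suc n)
    ≡⟨ ⊛-suc f (f ^S m) n ⟩
  f 0 * (f ^S m) (suc n) + (shift f ⊛ (f ^S m)) n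
    ≡⟨ cong₂ _+_ (trans (cong (_* (f ^S m) (suc n)) f₀≡0) (ℚP.*-zeroˡ ((f ^S m) (suc n))))
                 (⊛-zeroʳ-≤ n (shift f) (λ i i≤n → ^S-vanishes-below f f₀≡0 m i (ℕP.≤-<-trans i≤n n<m))) ⟩
  0ℚ + 0ℚ
    ≡⟨⟩
  0ℚ ∎
  where open ≡-Reasoning

^S-negS : ∀ N f → (negS f ^S N) ≈ alt N · (f ^S N)
^S-negS zero    f n = sym (ℚP.*-identityˡ (oneS n))
^S-negS (suc N) f n = begin
  (negS f ⊛ (negS f ^S N)) n            ≡⟨ ⊛-congˡ (negS f) (^S-negS N f) n ⟩
  (negS f ⊛ (alt N · (f ^S N))) n       ≡⟨ ⊛-congʳ (alt N · (f ^S N)) (λ i → solve 1 (λ x → :- x := (:- con 1ℚ) :* x) refl (f i)) n ⟩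
  ((- 1ℚ · f) ⊛ (alt N · (f ^S N))) n   ≡⟨ ·-⊛-assoc (- 1ℚ) f (alt N · (f ^S N)) n ⟩
  - 1ℚ * (f ⊛ (alt N · (f ^S N))) n     ≡⟨ cong (- 1ℚ *_) (⊛-comm f (alt N · (f ^S N)) n) ⟩
  - 1ℚ * ((alt N · (f ^S N)) ⊛ f) n     ≡⟨ cong (- 1ℚ *_) (·-⊛-assoc (alt N) (f ^S N) f n) ⟩
  - 1ℚ * (alt N * ((f ^S N) ⊛ f) n)     ≡⟨ cong (λ x → - 1ℚ * (alt N * x)) (⊛-comm (f ^S N) f n) ⟩
  - 1ℚ * (alt N * (f ⊛ (f ^S N)) n)     ≡⟨ solve 2 (λ a x → (:- con 1ℚ) :* (a :* x) := (:- a) :* x) refl (alt N) ((f ⊛ (f ^S N)) n) ⟩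
  - alt N * (f ⊛ (f ^S N)) n            ∎
  where open ≡-Reasoning

geometric-sum : ∀ B N → seriesSum N (B ^S_) ⊛ (oneS ⊖ B) ≈ oneS ⊖ (B ^S N)
geometric-sum B zero n = trans (⊛-zeroˡ (oneS ⊖ B) n) (sym (ℚP.+-inverseʳ (oneS n)))
geometric-sum B (suc N) = begin
  (seriesSum N (B ^S_) ⊕ (B ^S N)) ⊛ (oneS ⊖ B)                 ≈⟨ ⊛-distribʳ (seriesSum N (B ^S_)) (B ^S N) (oneS ⊖ B) ⟩
  (seriesSum N (B ^S_) ⊛ (oneS ⊖ B)) ⊕ ((B ^S N) ⊛ (oneS ⊖ B))  ≈⟨ ⊕-congʳ ((B ^S N) ⊛ (oneS ⊖ B)) (geometric-sum B N) ⟩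
  (oneS ⊖ (B ^S N)) ⊕ ((B ^S N) ⊛ (oneS ⊖ B))
    ≈⟨ ⊕-cong (⊕-congʳ (negS (B ^S N)) oneS≈constS1) (⊛-congˡ (B ^S N) (⊕-congʳ (negS B) oneS≈constS1)) ⟩
  (constS 1ℚ ⊖ (B ^S N)) ⊕ ((B ^S N) ⊛ (constS 1ℚ ⊖ B))
    ≈⟨ solveS 2 (λ b x → (conS 1ℚ :⊖ x) :⊕ (x :⊛ (conS 1ℚ :⊖ b)) :≈ conS 1ℚ :⊖ (b :⊛ x)) (λ _ → refl) B (B ^S N) ⟩
  constS 1ℚ ⊖ (B ⊛ (B ^S N))                                    ≈⟨ ⊕-congʳ (negS (B ⊛ (B ^S N))) oneS≈constS1 ⟨
  oneS ⊖ (B ⊛ (B ^S N))                                         ∎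
  where open ≈-Reasoning

^S-cong : ∀ {f g} k → f ≈ g → (f ^S k) ≈ (g ^S k)
^S-cong zero    f≈g = ≈-refl
^S-cong (suc k) f≈g = ⊛-cong f≈g (^S-cong k f≈g)

module _ (A : Series) (A₀≡1 : A 0 ≡ 1ℚ) where

  private
    B : Series
    B = oneS ⊖ A

    B₀≡0 : B 0 ≡ 0ℚ
    B₀≡0 = trans (cong (λ a → 1ℚ + - a) A₀≡1) (ℚP.+-inverseʳ 1ℚ)

    geometric : ℕ → Series
    geometric N = seriesSum N (B ^S_)

    C : Series
    C = A ⊖ oneS

    logPartial : ℕ → Series
    logPartial N = seriesSum N (λ j → (alt j * invSuc j) · (C ^S suc j))

    -- (1 − A)^m vanishes below degree m, so up to degree n the partial sum is exact.
    invS≈geometric : ∀ n → invS A ≈[≤ n ] geometric (suc n)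
    invS≈geometric n i i≤n = begin
      invS A i               ≡⟨ seriesSum-coeff (suc i) (B ^S_) i ⟨
      geometric (suc i) i    ≡⟨ seriesSum-stable (B ^S_) i (λ m i<m → ^S-vanishes-below B B₀≡0 m i i<m) (suc n) (s≤s i≤n) ⟨
      geometric (suc n) i    ∎
      where open ≡-Reasoning

    ∂C≈∂A : ∂ C ≈ ∂ A
    ∂C≈∂A n = cong (fromℕ (suc n) *_) (ℚP.+-identityʳ (A (suc n)))

    B≈negS-C : B ≈ negS C
    B≈negS-C n = solve 2 (λ o a → o :+ :- a := :- (a :+ :- o)) refl (oneS n) (A n)

    leading-term : ∀ N → (alt N * invSuc N) · (fromℕ (suc N) · ((C ^S N) ⊛ ∂ C)) ≈ (B ^S N) ⊛ ∂ A
    leading-term N n = begin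
      alt N * invSuc N * (fromℕ (suc N) * ((C ^S N) ⊛ ∂ C) n)
        ≡⟨ solve 4 (λ a b i x → a :* b :* (i :* x) := a :* (b :* i) :* x) refl (alt N) (invSuc N) (fromℕ (suc N)) (((C ^S N) ⊛ ∂ C) n) ⟩
      alt N * (invSuc N * fromℕ (suc N)) * ((C ^S N) ⊛ ∂ C) n
        ≡⟨ cong₂ (λ u v → alt N * u * v) (fromℕ-inverseˡ (suc N)) (⊛-congˡ (C ^S N) ∂C≈∂A n) ⟩
      alt N * 1ℚ * ((C ^S N) ⊛ ∂ A) n
        ≡⟨ cong (_* ((C ^S N) ⊛ ∂ A) n) (ℚP.*-identityʳ (alt N)) ⟩
      alt N * ((C ^S N) ⊛ ∂ A) n
        ≡⟨ ·-⊛-assoc (alt N) (C ^S N) (∂ A) n ⟨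
      ((alt N · (C ^S N)) ⊛ ∂ A) n
        ≡⟨ ⊛-congʳ (∂ A) (≈-trans (≈-sym (^S-negS N C)) (^S-cong N (≈-sym B≈negS-C))) n ⟩
      ((B ^S N) ⊛ ∂ A) n ∎
      where open ≡-Reasoning

    ∂-logPartial : ∀ N → ∂ (logPartial N) ≈ geometric N ⊛ ∂ A
    ∂-logPartial zero n = trans (ℚP.*-zeroʳ (fromℕ (suc n))) (sym (⊛-zeroˡ (∂ A) n))
    ∂-logPartial (suc N) = begin
      ∂ (logPartial N ⊕ (c · (C ^S suc N)))
        ≈⟨ ∂-⊕ (logPartial N) (c · (C ^S suc N)) ⟩
      ∂ (logPartial N) ⊕ ∂ (c · (C ^S suc N))
        ≈⟨ ⊕-cong (∂-logPartial N) (≈-trans (∂-· c (C ^S suc N)) (λ n → cong (c *_) (∂-^ N C n))) ⟩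
      (geometric N ⊛ ∂ A) ⊕ (c · (fromℕ (suc N) · ((C ^S N) ⊛ ∂ C)))
        ≈⟨ ⊕-congˡ (geometric N ⊛ ∂ A) (leading-term N) ⟩
      (geometric N ⊛ ∂ A) ⊕ ((B ^S N) ⊛ ∂ A)
        ≈⟨ ⊛-distribʳ (geometric N) (B ^S N) (∂ A) ⟨
      geometric (suc N) ⊛ ∂ A ∎
      where
      open ≈-Reasoning
      c = alt N * invSuc N

  invS-inverseˡ : invS A ⊛ A ≈ oneS
  invS-inverseˡ n = begin
    (invS A ⊛ A) n                       ≡⟨ ⊛-cong-≤ n (invS≈geometric n) (λ i _ → A≈1⊖B i) ⟩
    (geometric (suc n) ⊛ (oneS ⊖ B)) n   ≡⟨ geometric-sum B (suc n) n ⟩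
    oneS n + - (B ^S suc n) n            ≡⟨ cong (λ x → oneS n + - x) (^S-vanishes-below B B₀≡0 (suc n) n ℕP.≤-refl) ⟩
    oneS n + - 0ℚ                        ≡⟨ ℚP.+-identityʳ (oneS n) ⟩
    oneS n                               ∎
    where
    open ≡-Reasoning
    A≈1⊖B : A ≈ oneS ⊖ B
    A≈1⊖B i = solve 2 (λ o a → a := o :+ :- (o :+ :- a)) refl (oneS i) (A i)

  ∂-logS : ∂ (logS A) ≈ invS A ⊛ ∂ A
  ∂-logS n = begin
    fromℕ (suc n) * logS A (suc n)               ≡⟨ cong (fromℕ (suc n) *_) (seriesSum-coeff (suc n) _ (suc n)) ⟨
    ∂ (logPartial (suc n)) n                     ≡⟨ ∂-logPartial (suc n) n ⟩
    (geometric (suc n) ⊛ ∂ A) n                  ≡⟨ ⊛-cong-≤ n {g = ∂ A} (λ i i≤n → sym (invS≈geometric n i i≤n)) (λ _ _ → refl) ⟩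
    (invS A ⊛ ∂ A) n                             ∎
    where open ≡-Reasoning

-- Even and odd series

isEven : ℕ → Bool
isEven n = n % 2 ℕ.≡ᵇ 0

isEven-suc : ∀ n → isEven (suc n) ≡ not (isEven n)
isEven-suc zero          = refl
isEven-suc (suc zero)    = refl
isEven-suc (suc (suc n)) = isEven-suc n

isEven-pred : ∀ n {b} → isEven (suc n) ≡ not b → isEven n ≡ b
isEven-pred n {b} e = begin
  isEven n              ≡⟨ not-involutive (isEven n) ⟨
  not (not (isEven n))  ≡⟨ cong not (trans (sym (isEven-suc n)) e) ⟩
  not (not b)           ≡⟨ not-involutive b ⟩
  b                     ∎
  where open ≡-Reasoning

isEven⇒2∣ : ∀ n → isEven n ≡ true → 2 ∣ n
isEven⇒2∣ n e = m%n≡0⇒n∣m n 2 (ℕP.≡ᵇ⇒≡ (n % 2) 0 (Equivalence.from T-≡ e))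

2∣⇒isEven : ∀ n → 2 ∣ n → isEven n ≡ true
2∣⇒isEven n 2∣n rewrite n∣m⇒m%n≡0 n 2 2∣n = refl

half-suc-suc : ∀ n → suc (suc n) ℕ./ 2 ≡ suc (n ℕ./ 2)
half-suc-suc n = ℕDM.m/n≡1+[m∸n]/n {suc (suc n)} {2} (s≤s (s≤s z≤n))

half-suc-even : ∀ n → isEven n ≡ true → suc n ℕ./ 2 ≡ n ℕ./ 2
half-suc-even zero          _ = refl
half-suc-even (suc (suc n)) e = trans (half-suc-suc (suc n)) (trans (cong suc (half-suc-even n e)) (sym (half-suc-suc n)))

half-suc-odd : ∀ n → isEven n ≡ false → suc n ℕ./ 2 ≡ suc (n ℕ./ 2)
half-suc-odd (suc zero)    _ = refl
half-suc-odd (suc (suc n)) e = trans (half-suc-suc (suc n)) (cong suc (trans (half-suc-odd n e) (sym (half-suc-suc n))))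

Even : Series → Set
Even f = ∀ n → isEven n ≡ false → f n ≡ 0ℚ

Odd : Series → Set
Odd f = ∀ n → isEven n ≡ true → f n ≡ 0ℚ

shift-even : ∀ {f} → Even f → Odd (shift f)
shift-even f-even n e = f-even (suc n) (trans (isEven-suc n) (cong not e))

shift-odd : ∀ {f} → Odd f → Even (shift f)
shift-odd f-odd n e = f-odd (suc n) (trans (isEven-suc n) (cong not e))

mutual
  ⊛-even : ∀ {f g} → Even f → Even g → Even (f ⊛ g)
  ⊛-even {f} {g} f-even g-even (suc n) e = begin
    (f ⊛ g) (suc n)                     ≡⟨ ⊛-suc f g n ⟩
    f 0 * g (suc n) + (shift f ⊛ g) n   ≡⟨ cong₂ _+_ (trans (cong (f 0 *_) (g-even (suc n) e)) (ℚP.*-zeroʳ (f 0)))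
                                                     (⊛-odd (shift-even f-even) g-even n (isEven-pred n e)) ⟩
    0ℚ + 0ℚ                             ≡⟨⟩
    0ℚ                                  ∎
    where open ≡-Reasoning

  ⊛-odd : ∀ {f g} → Odd f → Even g → Odd (f ⊛ g)
  ⊛-odd {f} {g} f-odd g-even zero    _ = trans (⊛-0 f g) (trans (cong (_* g 0) (f-odd 0 refl)) (ℚP.*-zeroˡ (g 0)))
  ⊛-odd {f} {g} f-odd g-even (suc n) e = begin
    (f ⊛ g) (suc n)                     ≡⟨ ⊛-suc f g n ⟩
    f 0 * g (suc n) + (shift f ⊛ g) n   ≡⟨ cong₂ _+_ (trans (cong (_* g (suc n)) (f-odd 0 refl)) (ℚP.*-zeroˡ (g (suc n))))
                                                     (⊛-even (shift-odd f-odd) g-even n (isEven-pred n e)) ⟩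
    0ℚ + 0ℚ                             ≡⟨⟩
    0ℚ                                  ∎
    where open ≡-Reasoning

oneS-even : Even oneS
oneS-even (suc n) _ = refl

⊖-even : ∀ {f g} → Even f → Even g → Even (f ⊖ g)
⊖-even f-even g-even n e = cong₂ (λ a b → a + - b) (f-even n e) (g-even n e)

^S-even : ∀ {f} k → Even f → Even (f ^S k)
^S-even zero    f-even = oneS-even
^S-even (suc k) f-even = ⊛-even f-even (^S-even k f-even)

seriesSum-even : ∀ N F → (∀ m → Even (F m)) → Even (seriesSum N F)
seriesSum-even zero    F F-even n e = refl
seriesSum-even (suc N) F F-even n e = cong₂ _+_ (seriesSum-even N F F-even n e) (F-even N n e)

invS-even : ∀ {A} → Even A → Even (invS A)
invS-even {A} A-even n e =
  trans (sym (seriesSum-coeff (suc n) ((oneS ⊖ A) ^S_) n))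
        (seriesSum-even (suc n) _ (λ m → ^S-even m (⊖-even oneS-even A-even)) n e)

-- Sine, cosine, secant and tangent

scaled-inv!-suc : ∀ c n → fromℕ (suc n) * (c * inv! (suc n)) ≡ c * inv! n
scaled-inv!-suc c n = begin
  fromℕ (suc n) * (c * inv! (suc n))   ≡⟨ solve 3 (λ i c v → i :* (c :* v) := c :* (i :* v)) refl (fromℕ (suc n)) c (inv! (suc n)) ⟩
  c * (fromℕ (suc n) * inv! (suc n))   ≡⟨ cong (c *_) (fromℕ-suc*inv!-suc n) ⟩
  c * inv! n                           ∎
  where open ≡-Reasoning

sinS-suc : ∀ n → sinS (suc n) ≡ (if isEven n then alt (n ℕ./ 2) * inv! (suc n) else 0ℚ)
sinS-suc n = by-parity (isEven n) refl
  where
  by-parity : ∀ b → isEven n ≡ b →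
    (if isEven (suc n) then 0ℚ else alt (suc n ℕ./ 2) * inv! (suc n)) ≡ (if b then alt (n ℕ./ 2) * inv! (suc n) else 0ℚ)
  by-parity true  e rewrite isEven-suc n | e = cong (λ k → alt k * inv! (suc n)) (half-suc-even n e)
  by-parity false e rewrite isEven-suc n | e = refl

cosS-suc : ∀ n → cosS (suc n) ≡ (if isEven n then 0ℚ else - alt (n ℕ./ 2) * inv! (suc n))
cosS-suc n = by-parity (isEven n) refl
  where
  by-parity : ∀ b → isEven n ≡ b →
    (if isEven (suc n) then alt (suc n ℕ./ 2) * inv! (suc n) else 0ℚ) ≡ (if b then 0ℚ else - alt (n ℕ./ 2) * inv! (suc n))
  by-parity true  e rewrite isEven-suc n | e = refl
  by-parity false e rewrite isEven-suc n | e = cong (λ k → alt k * inv! (suc n)) (half-suc-odd n e)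

∂-sinS : ∂ sinS ≈ cosS
∂-sinS n = trans (cong (fromℕ (suc n) *_) (sinS-suc n)) (by-parity (isEven n))
  where
  by-parity : ∀ b → fromℕ (suc n) * (if b then alt (n ℕ./ 2) * inv! (suc n) else 0ℚ) ≡ (if b then alt (n ℕ./ 2) * inv! n else 0ℚ)
  by-parity true  = scaled-inv!-suc (alt (n ℕ./ 2)) n
  by-parity false = ℚP.*-zeroʳ (fromℕ (suc n))

∂-cosS : ∂ cosS ≈ negS sinS
∂-cosS n = trans (cong (fromℕ (suc n) *_) (cosS-suc n)) (by-parity (isEven n))
  where
  by-parity : ∀ b → fromℕ (suc n) * (if b then 0ℚ else - alt (n ℕ./ 2) * inv! (suc n)) ≡ - (if b then 0ℚ else alt (n ℕ./ 2) * inv! n)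
  by-parity true  = ℚP.*-zeroʳ (fromℕ (suc n))
  by-parity false = trans (scaled-inv!-suc (- alt (n ℕ./ 2)) n) (sym (ℚP.neg-distribˡ-* (alt (n ℕ./ 2)) (inv! n)))

sinS-odd : Odd sinS
sinS-odd n e rewrite e = refl

cosS-even : Even cosS
cosS-even n e rewrite e = refl

sin²+cos²≈1 : (sinS ⊛ sinS) ⊕ (cosS ⊛ cosS) ≈ constS 1ℚ
sin²+cos²≈1 = ∂≈0⇒constant ((sinS ⊛ sinS) ⊕ (cosS ⊛ cosS)) (begin
  ∂ ((sinS ⊛ sinS) ⊕ (cosS ⊛ cosS))
    ≈⟨ ≈-trans (∂-⊕ (sinS ⊛ sinS) (cosS ⊛ cosS)) (⊕-cong (∂-⊛ sinS sinS) (∂-⊛ cosS cosS)) ⟩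
  ((∂ sinS ⊛ sinS) ⊕ (sinS ⊛ ∂ sinS)) ⊕ ((∂ cosS ⊛ cosS) ⊕ (cosS ⊛ ∂ cosS))
    ≈⟨ ⊕-cong (⊕-cong (⊛-congʳ sinS ∂-sinS) (⊛-congˡ sinS ∂-sinS)) (⊕-cong (⊛-congʳ cosS ∂-cosS) (⊛-congˡ cosS ∂-cosS)) ⟩
  ((cosS ⊛ sinS) ⊕ (sinS ⊛ cosS)) ⊕ ((negS sinS ⊛ cosS) ⊕ (cosS ⊛ negS sinS))
    ≈⟨ solveS 2 (λ s c → ((c :⊛ s) :⊕ (s :⊛ c)) :⊕ (((:⊝ s) :⊛ c) :⊕ (c :⊛ (:⊝ s))) :≈ conS 0ℚ) (λ _ → refl) sinS cosS ⟩
  constS 0ℚ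
    ≈⟨ (λ n → ℚP.*-zeroˡ (oneS n)) ⟩
  zeroS
    ∎)
  where open ≈-Reasoning

∂-reciprocal : ∀ f g → f ⊛ g ≈ oneS → ∂ f ≈ negS ((f ⊛ f) ⊛ ∂ g)
∂-reciprocal f g fg≈1 = begin
  ∂ f
    ≈⟨ ⊛-identityʳ (∂ f) ⟨
  ∂ f ⊛ oneS
    ≈⟨ ⊛-congˡ (∂ f) fg≈1 ⟨
  ∂ f ⊛ (f ⊛ g)
    ≈⟨ solveS 4 (λ df f g dg → df :⊛ (f :⊛ g) :≈ f :⊛ (((df :⊛ g) :⊕ (f :⊛ dg)) :⊖ (f :⊛ dg))) (λ _ → refl) (∂ f) f g (∂ g) ⟩
  f ⊛ (((∂ f ⊛ g) ⊕ (f ⊛ ∂ g)) ⊖ (f ⊛ ∂ g))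
    ≈⟨ ⊛-congˡ f (⊕-congʳ (negS (f ⊛ ∂ g)) ∂[fg]≈0) ⟩
  f ⊛ (zeroS ⊖ (f ⊛ ∂ g))
    ≈⟨ ⊛-congˡ f (λ n → ℚP.+-identityˡ (- (f ⊛ ∂ g) n)) ⟩
  f ⊛ negS (f ⊛ ∂ g)
    ≈⟨ solveS 2 (λ f dg → f :⊛ (:⊝ (f :⊛ dg)) :≈ :⊝ ((f :⊛ f) :⊛ dg)) (λ _ → refl) f (∂ g) ⟩
  negS ((f ⊛ f) ⊛ ∂ g) ∎
  where
  open ≈-Reasoning
  ∂[fg]≈0 : (∂ f ⊛ g) ⊕ (f ⊛ ∂ g) ≈ zeroS
  ∂[fg]≈0 = ≈-trans (≈-sym (∂-⊛ f g)) (≈-trans (∂-cong fg≈1) ∂-oneS)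

secS⊛cosS≈1 : secS ⊛ cosS ≈ oneS
secS⊛cosS≈1 = invS-inverseˡ cosS refl

∂-secS : ∂ secS ≈ (secS ⊛ secS) ⊛ sinS
∂-secS = begin
  ∂ secS                                   ≈⟨ ∂-reciprocal secS cosS secS⊛cosS≈1 ⟩
  negS ((secS ⊛ secS) ⊛ ∂ cosS)            ≈⟨ (λ n → cong -_ (⊛-congˡ (secS ⊛ secS) ∂-cosS n)) ⟩
  negS ((secS ⊛ secS) ⊛ negS sinS)         ≈⟨ solveS 2 (λ s x → :⊝ ((s :⊛ s) :⊛ (:⊝ x)) :≈ (s :⊛ s) :⊛ x) (λ _ → refl) secS sinS ⟩
  (secS ⊛ secS) ⊛ sinS                     ∎
  where open ≈-Reasoning

secS-even : Even secS
secS-even = invS-even cosS-even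

tanS-odd : Odd tanS
tanS-odd = ⊛-odd sinS-odd secS-even

secTan : Series
secTan = secS ⊕ tanS

∂-secTan : ∂ secTan ≈ secS ⊛ secTan
∂-secTan = begin
  ∂ (secS ⊕ (sinS ⊛ secS))
    ≈⟨ ≈-trans (∂-⊕ secS (sinS ⊛ secS)) (⊕-congˡ (∂ secS) (∂-⊛ sinS secS)) ⟩
  ∂ secS ⊕ ((∂ sinS ⊛ secS) ⊕ (sinS ⊛ ∂ secS))
    ≈⟨ ⊕-cong ∂-secS (⊕-cong (⊛-congʳ secS ∂-sinS) (⊛-congˡ sinS ∂-secS)) ⟩
  ((secS ⊛ secS) ⊛ sinS) ⊕ ((cosS ⊛ secS) ⊕ (sinS ⊛ ((secS ⊛ secS) ⊛ sinS)))
    ≈⟨ solveS 3 (λ sc s c → ((sc :⊛ sc) :⊛ s) :⊕ ((c :⊛ sc) :⊕ (s :⊛ ((sc :⊛ sc) :⊛ s)))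
                         :≈ ((sc :⊛ sc) :⊛ (((s :⊛ s) :⊕ (c :⊛ c)) :⊕ s)) :⊕ ((c :⊛ sc) :⊛ (conS 1ℚ :⊖ (sc :⊛ c)))) (λ _ → refl) secS sinS cosS ⟩
  ((secS ⊛ secS) ⊛ (((sinS ⊛ sinS) ⊕ (cosS ⊛ cosS)) ⊕ sinS)) ⊕ ((cosS ⊛ secS) ⊛ (constS 1ℚ ⊖ (secS ⊛ cosS)))
    ≈⟨ ⊕-cong (⊛-congˡ (secS ⊛ secS) (⊕-congʳ sinS sin²+cos²≈1))
              (⊛-congˡ (cosS ⊛ secS) (⊖-congˡ (constS 1ℚ) (≈-trans secS⊛cosS≈1 oneS≈constS1))) ⟩
  ((secS ⊛ secS) ⊛ (constS 1ℚ ⊕ sinS)) ⊕ ((cosS ⊛ secS) ⊛ (constS 1ℚ ⊖ constS 1ℚ))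
    ≈⟨ solveS 3 (λ sc s c → ((sc :⊛ sc) :⊛ (conS 1ℚ :⊕ s)) :⊕ ((c :⊛ sc) :⊛ (conS 1ℚ :⊖ conS 1ℚ))
                         :≈ sc :⊛ (sc :⊕ (s :⊛ sc))) (λ _ → refl) secS sinS cosS ⟩
  secS ⊛ (secS ⊕ (sinS ⊛ secS))
    ∎
  where open ≈-Reasoning

-- Exponential generating functions

∂-dividedPower : ∀ L k → ∂ (inv! (suc k) · (L ^S suc k)) ≈ ∂ L ⊛ (inv! k · (L ^S k))
∂-dividedPower L k n = begin
  fromℕ (suc n) * (inv! (suc k) * (L ^S suc k) (suc n))
    ≡⟨ ∂-· (inv! (suc k)) (L ^S suc k) n ⟩
  inv! (suc k) * ∂ (L ^S suc k) n
    ≡⟨ cong (inv! (suc k) *_) (∂-^ k L n) ⟩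
  inv! (suc k) * (fromℕ (suc k) * ((L ^S k) ⊛ ∂ L) n)
    ≡⟨ solve 3 (λ v i x → v :* (i :* x) := i :* v :* x) refl (inv! (suc k)) (fromℕ (suc k)) (((L ^S k) ⊛ ∂ L) n) ⟩
  fromℕ (suc k) * inv! (suc k) * ((L ^S k) ⊛ ∂ L) n
    ≡⟨ cong (_* ((L ^S k) ⊛ ∂ L) n) (fromℕ-suc*inv!-suc k) ⟩
  inv! k * ((L ^S k) ⊛ ∂ L) n
    ≡⟨ ·-⊛-assoc (inv! k) (L ^S k) (∂ L) n ⟨
  ((inv! k · (L ^S k)) ⊛ ∂ L) n
    ≡⟨ ⊛-comm (inv! k · (L ^S k)) (∂ L) n ⟩
  (∂ L ⊛ (inv! k · (L ^S k))) n ∎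
  where open ≡-Reasoning

∂-logS-secTan : ∂ (logS secTan) ≈ secS
∂-logS-secTan = begin
  ∂ (logS secTan)                         ≈⟨ ∂-logS secTan refl ⟩
  invS secTan ⊛ ∂ secTan                  ≈⟨ ⊛-congˡ (invS secTan) ∂-secTan ⟩
  invS secTan ⊛ (secS ⊛ secTan)           ≈⟨ solveS 3 (λ i s a → i :⊛ (s :⊛ a) :≈ s :⊛ (i :⊛ a)) (λ _ → refl) (invS secTan) secS secTan ⟩
  secS ⊛ (invS secTan ⊛ secTan)           ≈⟨ ⊛-congˡ secS (invS-inverseˡ secTan refl) ⟩
  secS ⊛ oneS                             ≈⟨ ⊛-identityʳ secS ⟩
  secS                                    ∎
  where open ≈-Reasoning

∂-secTanPowT : ∀ k → ∂ (secTanPowT (suc k)) ≈ secS ⊛ secTanPowT k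
∂-secTanPowT k = begin
  ∂ (secTanPowT (suc k))                           ≈⟨ ∂-cong (powT≈ (suc k)) ⟩
  ∂ (inv! (suc k) · (logS secTan ^S suc k))        ≈⟨ ∂-dividedPower (logS secTan) k ⟩
  ∂ (logS secTan) ⊛ (inv! k · (logS secTan ^S k))  ≈⟨ ⊛-cong ∂-logS-secTan (≈-sym (powT≈ k)) ⟩
  secS ⊛ secTanPowT k                              ∎
  where
  open ≈-Reasoning
  powT≈ : ∀ k → secTanPowT k ≈ inv! k · (logS secTan ^S k)
  powT≈ k n = ℚP.*-comm ((logS secTan ^S k) n) (inv! k)

-- binomialSum n F = Σ_{a+b=n} C(n,a) F a b, unfolded by Pascal's rule.
binomialSum : ℕ → (ℕ → ℕ → ℚ) → ℚ
binomialSum zero    F = F 0 0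
binomialSum (suc n) F = binomialSum n (λ a b → F (suc a) b) + binomialSum n (λ a b → F a (suc b))

binomialSum-cong : ∀ n {F G : ℕ → ℕ → ℚ} → (∀ a b → F a b ≡ G a b) → binomialSum n F ≡ binomialSum n G
binomialSum-cong zero    F≡G = F≡G 0 0
binomialSum-cong (suc n) F≡G = cong₂ _+_ (binomialSum-cong n (λ a b → F≡G (suc a) b)) (binomialSum-cong n (λ a b → F≡G a (suc b)))

labelled : Series → ℕ → ℚ
labelled f n = fromℕ (n !) * f n

labelled-∂ : ∀ f n → labelled (∂ f) n ≡ labelled f (suc n)
labelled-∂ f n = begin
  fromℕ (n !) * (fromℕ (suc n) * f (suc n))
    ≡⟨ solve 3 (λ a b x → a :* (b :* x) := b :* a :* x) refl (fromℕ (n !)) (fromℕ (suc n)) (f (suc n)) ⟩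
  fromℕ (suc n) * fromℕ (n !) * f (suc n)
    ≡⟨ cong (_* f (suc n)) (fromℕ-* (suc n) (n !)) ⟨
  fromℕ (suc n !) * f (suc n) ∎
  where open ≡-Reasoning

labelled-⊛ : ∀ n f g → labelled (f ⊛ g) n ≡ binomialSum n (λ a b → labelled f a * labelled g b)
labelled-⊛ zero f g = begin
  1ℚ * (f ⊛ g) 0           ≡⟨ cong (1ℚ *_) (⊛-0 f g) ⟩
  1ℚ * (f 0 * g 0)         ≡⟨ solve 2 (λ x y → con 1ℚ :* (x :* y) := (con 1ℚ :* x) :* (con 1ℚ :* y)) refl (f 0) (g 0) ⟩
  (1ℚ * f 0) * (1ℚ * g 0)  ∎
  where open ≡-Reasoning
labelled-⊛ (suc n) f g = begin
  labelled (f ⊛ g) (suc n)                         ≡⟨ labelled-∂ (f ⊛ g) n ⟨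
  fromℕ (n !) * ∂ (f ⊛ g) n                        ≡⟨ cong (fromℕ (n !) *_) (∂-⊛ f g n) ⟩
  fromℕ (n !) * ((∂ f ⊛ g) n + (f ⊛ ∂ g) n)        ≡⟨ ℚP.*-distribˡ-+ (fromℕ (n !)) ((∂ f ⊛ g) n) ((f ⊛ ∂ g) n) ⟩
  labelled (∂ f ⊛ g) n + labelled (f ⊛ ∂ g) n      ≡⟨ cong₂ _+_ (labelled-⊛ n (∂ f) g) (labelled-⊛ n f (∂ g)) ⟩
  binomialSum n (λ a b → labelled (∂ f) a * labelled g b) + binomialSum n (λ a b → labelled f a * labelled (∂ g) b)
    ≡⟨ cong₂ _+_ (binomialSum-cong n (λ a b → cong (_* labelled g b) (labelled-∂ f a)))
                 (binomialSum-cong n (λ a b → cong (labelled f a *_) (labelled-∂ g b))) ⟩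
  binomialSum (suc n) (λ a b → labelled f a * labelled g b) ∎
  where open ≡-Reasoning

data LrminConstraint : Set where
  unconstrained : LrminConstraint
  exactly       : ℕ → LrminConstraint

Satisfies : ℕ → LrminConstraint → Set
Satisfies l unconstrained = ⊤
Satisfies l (exactly k)   = l ≡ k

egf : LrminConstraint → Series
egf unconstrained = secTan
egf (exactly k)   = secTanPowT k

-- c ⇝ c′: a word σ m τ, with m its minimum, satisfies c exactly when σ satisfies c′.
data _⇝_ : LrminConstraint → LrminConstraint → Set where
  unconstrained⇝ : unconstrained ⇝ unconstrained
  exactly⇝       : ∀ k → exactly (suc k) ⇝ exactly k

Satisfies-suc⁺ : ∀ {c c′ l} → c ⇝ c′ → Satisfies l c′ → Satisfies (suc l) c
Satisfies-suc⁺ unconstrained⇝ _   = tt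
Satisfies-suc⁺ (exactly⇝ k)   l≡k = cong suc l≡k

Satisfies-suc⁻ : ∀ c {l} → Satisfies (suc l) c → Σ LrminConstraint λ c′ → c ⇝ c′ × Satisfies l c′
Satisfies-suc⁻ unconstrained     _        = unconstrained , unconstrained⇝ , tt
Satisfies-suc⁻ (exactly (suc k)) 1+l≡1+k  = exactly k , exactly⇝ k , ℕP.suc-injective 1+l≡1+k

∂-egf : ∀ {c c′} → c ⇝ c′ → ∂ (egf c) ≈ secS ⊛ egf c′
∂-egf unconstrained⇝ = ∂-secTan
∂-egf (exactly⇝ k)   = ∂-secTanPowT k

secTanPowT-suc-0 : ∀ k → secTanPowT (suc k) 0 ≡ 0ℚ
secTanPowT-suc-0 k = trans (cong (_* inv! (suc k)) (trans (⊛-0 L (L ^S k)) (ℚP.*-zeroˡ ((L ^S k) 0)))) (ℚP.*-zeroˡ (inv! (suc k)))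
  where L = logS secTan

labelled-egf-suc : ∀ {c c′} → c ⇝ c′ → ∀ n →
  labelled (egf c) (suc n) ≡ binomialSum n (λ t u → if isEven t then labelled (egf c′) u * labelled secTan t else 0ℚ)
labelled-egf-suc {c} {c′} c⇝c′ n = begin
  labelled (egf c) (suc n)                                      ≡⟨ labelled-∂ (egf c) n ⟨
  labelled (∂ (egf c)) n                                        ≡⟨ cong (fromℕ (n !) *_) (∂-egf c⇝c′ n) ⟩
  labelled (secS ⊛ egf c′) n                                    ≡⟨ labelled-⊛ n secS (egf c′) ⟩
  binomialSum n (λ t u → labelled secS t * labelled (egf c′) u)  ≡⟨ binomialSum-cong n (λ t u → by-parity t u (isEven t) refl) ⟩
  binomialSum n (λ t u → if isEven t then labelled (egf c′) u * labelled secTan t else 0ℚ) ∎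
  where
  open ≡-Reasoning
  by-parity : ∀ t u b → isEven t ≡ b →
    labelled secS t * labelled (egf c′) u ≡ (if b then labelled (egf c′) u * labelled secTan t else 0ℚ)
  by-parity t u true  e = trans (ℚP.*-comm (labelled secS t) (labelled (egf c′) u))
    (cong (λ x → labelled (egf c′) u * (fromℕ (t !) * x)) (sym (trans (cong (secS t +_) (tanS-odd t e)) (ℚP.+-identityʳ (secS t)))))
  by-parity t u false e = trans (cong (λ x → fromℕ (t !) * x * labelled (egf c′) u) (secS-even t e))
    (trans (cong (_* labelled (egf c′) u) (ℚP.*-zeroʳ (fromℕ (t !)))) (ℚP.*-zeroˡ (labelled (egf c′) u)))

-- Words σ m τ with least letter m

<⇒<ᵇ≡true : ∀ {m n} → m < n → (m <ᵇ n) ≡ true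
<⇒<ᵇ≡true m<n = Equivalence.to T-≡ (ℕP.<⇒<ᵇ m<n)

≥⇒<ᵇ≡false : ∀ {m n} → m ≥ n → (m <ᵇ n) ≡ false
≥⇒<ᵇ≡false {n = zero}      _         = refl
≥⇒<ᵇ≡false {suc m} {suc n} (s≤s n≤m) = ≥⇒<ᵇ≡false n≤m

rhoLen-++-∷ : ∀ {m x} → m < x → ∀ σ τ → rhoLen x (σ ++ m ∷ τ) ≡ rhoLen x σ
rhoLen-++-∷ m<x []      τ rewrite ≥⇒<ᵇ≡false (ℕP.<⇒≤ m<x) = refl
rhoLen-++-∷ {x = x} m<x (y ∷ σ) τ with x <ᵇ y
... | true  = cong suc (rhoLen-++-∷ m<x σ τ)
... | false = refl

rhoLen-above : ∀ m τ → All (m <_) τ → rhoLen m τ ≡ length τ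
rhoLen-above m []      []           = refl
rhoLen-above m (y ∷ τ) (m<y ∷ m<τ) rewrite <⇒<ᵇ≡true m<y = cong suc (rhoLen-above m τ m<τ)

Jacobi-++-∷⁺ : ∀ m σ τ → All (m <_) σ → Jacobi σ → Jacobi (m ∷ τ) → Jacobi (σ ++ m ∷ τ)
Jacobi-++-∷⁺ m []      τ _           _           jτ = jτ
Jacobi-++-∷⁺ m (x ∷ σ) τ (m<x ∷ m<σ) (2∣ρx , jσ) jτ =
  subst (2 ∣_) (sym (rhoLen-++-∷ m<x σ τ)) 2∣ρx , Jacobi-++-∷⁺ m σ τ m<σ jσ jτ

Jacobi-++-∷⁻ : ∀ m σ τ → All (m <_) σ → Jacobi (σ ++ m ∷ τ) → Jacobi σ × Jacobi (m ∷ τ)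
Jacobi-++-∷⁻ m []      τ _           j          = tt , j
Jacobi-++-∷⁻ m (x ∷ σ) τ (m<x ∷ m<σ) (2∣ρx , j) =
  let jσ , jτ = Jacobi-++-∷⁻ m σ τ m<σ j in (subst (2 ∣_) (rhoLen-++-∷ m<x σ τ) 2∣ρx , jσ) , jτ

lrminFrom-above : ∀ m τ → All (m <_) τ → lrminFrom m τ ≡ 0
lrminFrom-above m []      []           = refl
lrminFrom-above m (z ∷ τ) (m<z ∷ m<τ) rewrite ≥⇒<ᵇ≡false (ℕP.<⇒≤ m<z) = lrminFrom-above m τ m<τ

lrminFrom-++-∷ : ∀ m y σ τ → m < y → All (m <_) σ → All (m <_) τ → lrminFrom y (σ ++ m ∷ τ) ≡ suc (lrminFrom y σ)
lrminFrom-++-∷ m y []      τ m<y _           m<τ rewrite <⇒<ᵇ≡true m<y = cong suc (lrminFrom-above m τ m<τ)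
lrminFrom-++-∷ m y (z ∷ σ) τ m<y (m<z ∷ m<σ) m<τ with z <ᵇ y
... | true  = cong suc (lrminFrom-++-∷ m z σ τ m<z m<σ m<τ)
... | false = lrminFrom-++-∷ m y σ τ m<y m<σ m<τ

lrmin-++-∷ : ∀ m σ τ → All (m <_) σ → All (m <_) τ → lrmin (σ ++ m ∷ τ) ≡ suc (lrmin σ)
lrmin-++-∷ m []      τ _           m<τ = cong suc (lrminFrom-above m τ m<τ)
lrmin-++-∷ m (x ∷ σ) τ (m<x ∷ m<σ) m<τ = cong suc (lrminFrom-++-∷ m x σ τ m<x m<σ m<τ)

-- Interleavings and gluing

unshuffles : ∀ {A : Set} → List A → List (List A × List A)
unshuffles []      = ([] , []) ∷ []
unshuffles (x ∷ R) = map (Prod.map₁ (x ∷_)) (unshuffles R) ++ map (Prod.map₂ (x ∷_)) (unshuffles R)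

module _ {A : Set} where

  ∈-unshuffles⁺ : ∀ {R T U : List A} → Interleaving T U R → (T , U) ∈ unshuffles R
  ∈-unshuffles⁺ []               = here refl
  ∈-unshuffles⁺ {x ∷ R} (consˡ sp) = ∈-++⁺ˡ (∈-map⁺ (Prod.map₁ (x ∷_)) (∈-unshuffles⁺ sp))
  ∈-unshuffles⁺ {x ∷ R} (consʳ sp) = ∈-++⁺ʳ (map (Prod.map₁ (x ∷_)) (unshuffles R)) (∈-map⁺ (Prod.map₂ (x ∷_)) (∈-unshuffles⁺ sp))

  ∈-unshuffles⁻ : ∀ (R : List A) {T U} → (T , U) ∈ unshuffles R → Interleaving T U R
  ∈-unshuffles⁻ []      (here refl) = []
  ∈-unshuffles⁻ (x ∷ R) p∈ with ∈-++⁻ (map (Prod.map₁ (x ∷_)) (unshuffles R)) p∈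
  ... | inj₁ p∈ˡ with _ , q∈ , refl ← ∈-map⁻ (Prod.map₁ (x ∷_)) p∈ˡ = consˡ (∈-unshuffles⁻ R q∈)
  ... | inj₂ p∈ʳ with _ , q∈ , refl ← ∈-map⁻ (Prod.map₂ (x ∷_)) p∈ʳ = consʳ (∈-unshuffles⁻ R q∈)

  All-⊆ : ∀ {P : A → Set} {xs ys} → (∀ {y} → y ∈ xs → y ∈ ys) → All P ys → All P xs
  All-⊆ xs⊆ys pys = All.tabulate (All.lookup pys ∘ xs⊆ys)

  Interleaving-⊆ˡ : ∀ {R T U : List A} {y} → Interleaving T U R → y ∈ T → y ∈ R
  Interleaving-⊆ˡ sp y∈T = ∈-resp-↭ (↭-sym (toPermutation sp)) (∈-++⁺ˡ y∈T)

  Interleaving-⊆ʳ : ∀ {R T U : List A} {y} → Interleaving T U R → y ∈ U → y ∈ R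
  Interleaving-⊆ʳ {T = T} sp y∈U = ∈-resp-↭ (↭-sym (toPermutation sp)) (∈-++⁺ʳ T y∈U)

  Interleaving-length≤ˡ : ∀ {R T U : List A} → Interleaving T U R → length T ≤ length R
  Interleaving-length≤ˡ {T = T} {U} sp = subst (length T ≤_) (sym (interleave-length sp)) (ℕP.m≤m+n (length T) (length U))

  Interleaving-length≤ʳ : ∀ {R T U : List A} → Interleaving T U R → length U ≤ length R
  Interleaving-length≤ʳ {T = T} {U} sp = subst (length U ≤_) (sym (interleave-length sp)) (ℕP.m≤n+m (length U) (length T))

  Interleaving-AllPairs : ∀ {P : A → A → Set} {R T U} → Interleaving T U R → AllPairs P R → AllPairs P T × AllPairs P U
  Interleaving-AllPairs []         []         = [] , []
  Interleaving-AllPairs (consˡ sp) (px ∷ pR) =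
    let pT , pU = Interleaving-AllPairs sp pR in All-⊆ (Interleaving-⊆ˡ sp) px ∷ pT , pU
  Interleaving-AllPairs (consʳ sp) (px ∷ pR) =
    let pT , pU = Interleaving-AllPairs sp pR in pT , All-⊆ (Interleaving-⊆ʳ sp) px ∷ pU

  unshuffles-sum : ∀ (R : List A) (H : List A × List A → ℚ) (F : ℕ → ℕ → ℚ) →
    (∀ {T U} → Interleaving T U R → H (T , U) ≡ F (length T) (length U)) →
    sumℚ (map H (unshuffles R)) ≡ binomialSum (length R) F
  unshuffles-sum []      H F H≡F = trans (ℚP.+-identityʳ (H ([] , []))) (H≡F [])
  unshuffles-sum (x ∷ R) H F H≡F = begin
    sumℚ (map H (map (Prod.map₁ (x ∷_)) us ++ map (Prod.map₂ (x ∷_)) us))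
      ≡⟨ cong sumℚ (LP.map-++ H (map (Prod.map₁ (x ∷_)) us) (map (Prod.map₂ (x ∷_)) us)) ⟩
    sumℚ (map H (map (Prod.map₁ (x ∷_)) us) ++ map H (map (Prod.map₂ (x ∷_)) us))
      ≡⟨ sumℚ-++ (map H (map (Prod.map₁ (x ∷_)) us)) (map H (map (Prod.map₂ (x ∷_)) us)) ⟩
    sumℚ (map H (map (Prod.map₁ (x ∷_)) us)) + sumℚ (map H (map (Prod.map₂ (x ∷_)) us))
      ≡⟨ cong₂ _+_ (cong sumℚ (LP.map-∘ us)) (cong sumℚ (LP.map-∘ us)) ⟨
    sumℚ (map (H ∘ Prod.map₁ (x ∷_)) us) + sumℚ (map (H ∘ Prod.map₂ (x ∷_)) us)
      ≡⟨ cong₂ _+_ (unshuffles-sum R (H ∘ Prod.map₁ (x ∷_)) (λ t u → F (suc t) u) (λ sp → H≡F (consˡ sp)))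
                   (unshuffles-sum R (H ∘ Prod.map₂ (x ∷_)) (λ t u → F t (suc u)) (λ sp → H≡F (consʳ sp))) ⟩
    binomialSum (suc (length R)) F
      ∎
    where
    open ≡-Reasoning
    us = unshuffles R

  Unique-map-proj₁-unshuffles : ∀ {R : List A} → Unique R → Unique (map proj₁ (unshuffles R))
  Unique-map-proj₁-unshuffles {[]}    _          = [] ∷ []
  Unique-map-proj₁-unshuffles {x ∷ R} (x∉R ∷ uR) = subst Unique (sym keys) (Unique.++⁺ (Unique.map⁺ LP.∷-injectiveʳ IH) IH disjoint)
    where
    us = unshuffles R
    IH = Unique-map-proj₁-unshuffles uR
    keys : map proj₁ (unshuffles (x ∷ R)) ≡ map (x ∷_) (map proj₁ us) ++ map proj₁ us
    keys = trans (LP.map-++ proj₁ (map (Prod.map₁ (x ∷_)) us) (map (Prod.map₂ (x ∷_)) us))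
                 (cong₂ _++_ (trans (sym (LP.map-∘ us)) (LP.map-∘ us)) (sym (LP.map-∘ us)))
    disjoint : ∀ {v} → ¬ (v ∈ map (x ∷_) (map proj₁ us) × v ∈ map proj₁ us)
    disjoint (v∈ˡ , v∈ʳ) with _ , _ , refl ← ∈-map⁻ (x ∷_) v∈ˡ | (T , U) , p∈ , refl ← ∈-map⁻ proj₁ v∈ʳ =
      All.lookup x∉R (Interleaving-⊆ˡ (∈-unshuffles⁻ R p∈) (here refl)) refl

  ↭-Interleaving : ∀ (R : List A) P Q → P ++ Q ↭ R → Σ (List A) λ T → Σ (List A) λ U → Interleaving T U R × P ↭ T × Q ↭ U
  ↭-Interleaving [] P Q P++Q↭[] with refl ← LP.++-conicalˡ P Q (↭-empty-inv P++Q↭[]) | refl ← LP.++-conicalʳ P Q (↭-empty-inv P++Q↭[]) =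
    [] , [] , [] , ↭-refl , ↭-refl
  ↭-Interleaving (x ∷ R) P Q P++Q↭xR with ∈-++⁻ P (∈-resp-↭ (↭-sym P++Q↭xR) (here refl))
  ... | inj₁ x∈P with P₁ , P₂ , refl ← ∈-∃++ x∈P =
    let P₁₂++Q↭R = subst (_↭ R) (sym (LP.++-assoc P₁ P₂ Q)) (drop-mid P₁ [] (subst (_↭ x ∷ R) (LP.++-assoc P₁ (x ∷ P₂) Q) P++Q↭xR))
        T , U , sp , P₁₂↭T , Q↭U = ↭-Interleaving R (P₁ ++ P₂) Q P₁₂++Q↭R
    in x ∷ T , U , consˡ sp , ↭-trans (↭-shift x P₁ P₂) (prep x P₁₂↭T) , Q↭U
  ... | inj₂ x∈Q with Q₁ , Q₂ , refl ← ∈-∃++ x∈Q =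
    let P++Q₁₂↭R = subst (_↭ R) (LP.++-assoc P Q₁ Q₂) (drop-mid (P ++ Q₁) [] (subst (_↭ x ∷ R) (sym (LP.++-assoc P Q₁ (x ∷ Q₂))) P++Q↭xR))
        T , U , sp , P↭T , Q₁₂↭U = ↭-Interleaving R P (Q₁ ++ Q₂) P++Q₁₂↭R
    in T , x ∷ U , consʳ sp , P↭T , ↭-trans (↭-shift x Q₁ Q₂) (prep x Q₁₂↭U)

Unique-concatMap : ∀ {A B K : Set} (h : A → List B) (tag : B → K) (label : A → K) {xs : List A} →
  Unique (map label xs) → (∀ {a} → a ∈ xs → Unique (h a)) → (∀ {a b} → a ∈ xs → b ∈ h a → tag b ≡ label a) →
  Unique (concatMap h xs)
Unique-concatMap h tag label {[]}     _            _      _      = []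
Unique-concatMap h tag label {a ∷ xs} (la∉ ∷ ulxs) unique tagged =
  Unique.++⁺ (unique (here refl)) (Unique-concatMap h tag label ulxs (unique ∘ there) (tagged ∘ there)) disjoint
  where
  disjoint : ∀ {v} → ¬ (v ∈ h a × v ∈ concatMap h xs)
  disjoint (v∈ha , v∈rest) with a′ , a′∈xs , v∈ha′ ← find (∈-concatMap⁻ h v∈rest) =
    All.lookup la∉ (∈-map⁺ label a′∈xs) (trans (sym (tagged (here refl) v∈ha)) (tagged (there a′∈xs) v∈ha′))

fromℕ-length-concatMap : ∀ {A B : Set} (h : A → List B) xs → fromℕ (length (concatMap h xs)) ≡ sumℚ (map (fromℕ ∘ length ∘ h) xs)
fromℕ-length-concatMap h []       = refl
fromℕ-length-concatMap h (x ∷ xs) = begin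
  fromℕ (length (h x ++ concatMap h xs))                     ≡⟨ cong fromℕ (LP.length-++ (h x)) ⟩
  fromℕ (length (h x) ℕ.+ length (concatMap h xs))           ≡⟨ fromℕ-+ (length (h x)) (length (concatMap h xs)) ⟩
  fromℕ (length (h x)) + fromℕ (length (concatMap h xs))     ≡⟨ cong (fromℕ (length (h x)) +_) (fromℕ-length-concatMap h xs) ⟩
  fromℕ (length (h x)) + sumℚ (map (fromℕ ∘ length ∘ h) xs)  ∎
  where open ≡-Reasoning

filter-∈-Interleaving : ∀ {R T U} (τ : List ℕ) → Unique R → Interleaving T U R →
  (∀ {y} → y ∈ R → y ∈ τ ⇔ y ∈ T) → filter (_∈? τ) R ≡ T
filter-∈-Interleaving τ _ [] _ = refl
filter-∈-Interleaving {x ∷ R} {x ∷ T} τ (x∉R ∷ uR) (consˡ sp) τ⇔T =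
  trans (LP.filter-accept (_∈? τ) (Equivalence.from (τ⇔T (here refl)) (here refl)))
        (cong (x ∷_) (filter-∈-Interleaving τ uR sp τ⇔T′))
  where
  τ⇔T′ : ∀ {y} → y ∈ R → y ∈ τ ⇔ y ∈ T
  τ⇔T′ {y} y∈R = mk⇔ (λ y∈τ → drop-x (Equivalence.to (τ⇔T (there y∈R)) y∈τ)) (λ y∈T → Equivalence.from (τ⇔T (there y∈R)) (there y∈T))
    where
    drop-x : y ∈ x ∷ T → y ∈ T
    drop-x (here y≡x)  = contradiction (sym y≡x) (All.lookup x∉R y∈R)
    drop-x (there y∈T) = y∈T
filter-∈-Interleaving {x ∷ R} τ (x∉R ∷ uR) (consʳ sp) τ⇔T =
  trans (LP.filter-reject (_∈? τ) x∉τ) (filter-∈-Interleaving τ uR sp (τ⇔T ∘ there))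
  where
  x∉τ : x ∉ τ
  x∉τ x∈τ = All.lookup x∉R (Interleaving-⊆ˡ sp (Equivalence.to (τ⇔T (here refl)) x∈τ)) refl

breakAt : ℕ → List ℕ → List ℕ × List ℕ
breakAt m []       = [] , []
breakAt m (x ∷ xs) with x ℕ.≟ m
... | yes _ = [] , xs
... | no  _ = Prod.map₁ (x ∷_) (breakAt m xs)

breakAt-++-∷ : ∀ m σ τ → m ∉ σ → breakAt m (σ ++ m ∷ τ) ≡ (σ , τ)
breakAt-++-∷ m []      τ _    with m ℕ.≟ m
... | yes _   = refl
... | no  m≢m = contradiction refl m≢m
breakAt-++-∷ m (x ∷ σ) τ m∉xσ with x ℕ.≟ m
... | yes refl = contradiction (here refl) m∉xσ
... | no  _    = cong (Prod.map₁ (x ∷_)) (breakAt-++-∷ m σ τ (m∉xσ ∘ there))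

∈-if⁻ : ∀ {A : Set} b {X : List A} {x} → x ∈ (if b then X else []) → b ≡ true × x ∈ X
∈-if⁻ true x∈X = refl , x∈X

∈-if⁺ : ∀ {A : Set} {b} {X : List A} {x} → b ≡ true → x ∈ X → x ∈ (if b then X else [])
∈-if⁺ refl x∈X = x∈X

Unique-if : ∀ {A : Set} b {X : List A} → Unique X → Unique (if b then X else [])
Unique-if true  uX = uX
Unique-if false _  = []

fromℕ-length-if : ∀ {A : Set} b {X : List A} {q} → fromℕ (length X) ≡ q → fromℕ (length (if b then X else [])) ≡ (if b then q else 0ℚ)
fromℕ-length-if true  eq = eq
fromℕ-length-if false _  = refl

glue : ℕ → List (List ℕ) → List (List ℕ) → List (List ℕ)
glue m σs τs = concatMap (λ σ → map (λ τ → σ ++ m ∷ τ) τs) σs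

∈-glue⁺ : ∀ m {σs τs σ τ} → σ ∈ σs → τ ∈ τs → σ ++ m ∷ τ ∈ glue m σs τs
∈-glue⁺ m {τs = τs} {σ} σ∈ τ∈ = ∈-concatMap⁺ (λ σ → map (λ τ → σ ++ m ∷ τ) τs) (lose σ∈ (∈-map⁺ (λ τ → σ ++ m ∷ τ) τ∈))

∈-glue⁻ : ∀ m σs τs {π} → π ∈ glue m σs τs → Σ (List ℕ) λ σ → Σ (List ℕ) λ τ → σ ∈ σs × τ ∈ τs × π ≡ σ ++ m ∷ τ
∈-glue⁻ m σs τs π∈ with σ , σ∈ , π∈στs ← find (∈-concatMap⁻ (λ σ → map (λ τ → σ ++ m ∷ τ) τs) {xs = σs} π∈)
                  with τ , τ∈ , refl ← ∈-map⁻ (λ τ → σ ++ m ∷ τ) π∈στs = σ , τ , σ∈ , τ∈ , refl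

length-glue : ∀ m σs τs → length (glue m σs τs) ≡ length σs ℕ.* length τs
length-glue m []       τs = refl
length-glue m (σ ∷ σs) τs =
  trans (LP.length-++ (map (λ τ → σ ++ m ∷ τ) τs)) (cong₂ ℕ._+_ (LP.length-map (λ τ → σ ++ m ∷ τ) τs) (length-glue m σs τs))

Unique-glue : ∀ m {σs τs} → Unique σs → Unique τs → (∀ {σ} → σ ∈ σs → m ∉ σ) → Unique (glue m σs τs)
Unique-glue m {σs} {τs} uσs uτs m∉σs =
  Unique-concatMap (λ σ → map (λ τ → σ ++ m ∷ τ) τs) (proj₁ ∘ breakAt m) (λ σ → σ) (subst Unique (sym (LP.map-id σs)) uσs)
    (λ {σ} _ → Unique.map⁺ (λ eq → LP.∷-injectiveʳ (LP.++-cancelˡ σ _ _ eq)) uτs)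
    (λ {σ} σ∈ π∈ → let τ , _ , π≡ = ∈-map⁻ (λ τ → σ ++ m ∷ τ) π∈ in
                   trans (cong (proj₁ ∘ breakAt m) π≡) (cong proj₁ (breakAt-++-∷ m σ τ (m∉σs σ∈))))

-- Enumerating Jacobi permutations

JacobiOn : List ℕ → LrminConstraint → List ℕ → Set
JacobiOn S c π = (π ↭ S) × Jacobi π × Satisfies (lrmin π) c

JacobiOn-++-∷ : ∀ {c c′ m R T U σ τ} → c ⇝ c′ → All (m <_) R → Interleaving T U R → isEven (length T) ≡ true →
  JacobiOn U c′ σ → JacobiOn T unconstrained τ → JacobiOn (m ∷ R) c (σ ++ m ∷ τ)
JacobiOn-++-∷ {c} {m = m} {R} {T} {U} {σ} {τ} c⇝c′ m<R sp even (σ↭U , jσ , σ-sat) (τ↭T , jτ , _) = perm , jac , sat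
  where
  m<σ = All-resp-↭ (↭-sym σ↭U) (All-⊆ (Interleaving-⊆ʳ sp) m<R)
  m<τ = All-resp-↭ (↭-sym τ↭T) (All-⊆ (Interleaving-⊆ˡ sp) m<R)
  perm : σ ++ m ∷ τ ↭ m ∷ R
  perm = ↭-trans (↭-shift m σ τ) (prep m (↭-trans (++⁺ σ↭U τ↭T) (↭-trans (++-comm U T) (↭-sym (toPermutation sp)))))
  jac : Jacobi (σ ++ m ∷ τ)
  jac = Jacobi-++-∷⁺ m σ τ m<σ jσ (subst (2 ∣_) (sym (trans (rhoLen-above m τ m<τ) (↭-length τ↭T))) (isEven⇒2∣ (length T) even) , jτ)
  sat : Satisfies (lrmin (σ ++ m ∷ τ)) c
  sat = subst (λ l → Satisfies l c) (sym (lrmin-++-∷ m σ τ m<σ m<τ)) (Satisfies-suc⁺ c⇝c′ σ-sat)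

-- The fuel f must be at least length S.  The alphabet S is increasing, so its head m is the least letter,
-- and glueBlock f m c′ (T , U) holds the words σ m τ with σ on U and τ on T.
mutual
  jacobiWords : ℕ → List ℕ → LrminConstraint → List (List ℕ)
  jacobiWords _       []      unconstrained     = [] ∷ []
  jacobiWords _       []      (exactly zero)    = [] ∷ []
  jacobiWords _       []      (exactly (suc _)) = []
  jacobiWords zero    (_ ∷ _) _                 = []
  jacobiWords (suc f) (m ∷ R) unconstrained     = glueAtMin f m R unconstrained
  jacobiWords (suc f) (m ∷ R) (exactly zero)    = []
  jacobiWords (suc f) (m ∷ R) (exactly (suc k)) = glueAtMin f m R (exactly k)

  glueAtMin : ℕ → ℕ → List ℕ → LrminConstraint → List (List ℕ)
  glueAtMin f m R c′ = concatMap (glueBlock f m c′) (unshuffles R)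

  glueBlock : ℕ → ℕ → LrminConstraint → List ℕ × List ℕ → List (List ℕ)
  glueBlock f m c′ (T , U) = if isEven (length T) then glue m (jacobiWords f U c′) (jacobiWords f T unconstrained) else []

jacobiWords-∷ : ∀ {c c′} f m R → c ⇝ c′ → jacobiWords (suc f) (m ∷ R) c ≡ glueAtMin f m R c′
jacobiWords-∷ f m R unconstrained⇝ = refl
jacobiWords-∷ f m R (exactly⇝ k)   = refl

mutual
  jacobiWords⁻ : ∀ f S c → length S ≤ f → AllPairs _<_ S → ∀ {π} → π ∈ jacobiWords f S c → JacobiOn S c π
  jacobiWords⁻ _       []      unconstrained     _         _   (here refl) = ↭-refl , tt , tt
  jacobiWords⁻ _       []      (exactly zero)    _         _   (here refl) = ↭-refl , tt , refl
  jacobiWords⁻ (suc f) (m ∷ R) unconstrained     (s≤s R≤f) inc π∈        = glueAtMin⁻ f m R unconstrained⇝ R≤f inc π∈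
  jacobiWords⁻ (suc f) (m ∷ R) (exactly (suc k)) (s≤s R≤f) inc π∈        = glueAtMin⁻ f m R (exactly⇝ k) R≤f inc π∈

  glueAtMin⁻ : ∀ {c c′} f m R → c ⇝ c′ → length R ≤ f → AllPairs _<_ (m ∷ R) →
    ∀ {π} → π ∈ glueAtMin f m R c′ → JacobiOn (m ∷ R) c π
  glueAtMin⁻ {c′ = c′} f m R c⇝c′ R≤f (m<R ∷ incR) π∈
    with (T , U) , TU∈ , π∈glueBlock ← find (∈-concatMap⁻ (glueBlock f m c′) {xs = unshuffles R} π∈)
    with even , π∈glue ← ∈-if⁻ (isEven (length T)) π∈glueBlock
    with σ , τ , σ∈ , τ∈ , refl ← ∈-glue⁻ m (jacobiWords f U c′) (jacobiWords f T unconstrained) π∈glue =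
    JacobiOn-++-∷ c⇝c′ m<R sp even
      (jacobiWords⁻ f U c′ (ℕP.≤-trans (Interleaving-length≤ʳ sp) R≤f) incU σ∈)
      (jacobiWords⁻ f T unconstrained (ℕP.≤-trans (Interleaving-length≤ˡ sp) R≤f) incT τ∈)
    where
    sp = ∈-unshuffles⁻ R TU∈
    incT = proj₁ (Interleaving-AllPairs sp incR)
    incU = proj₂ (Interleaving-AllPairs sp incR)

jacobiWords⁺ : ∀ f S c → length S ≤ f → AllPairs _<_ S → ∀ {π} → JacobiOn S c π → π ∈ jacobiWords f S c
jacobiWords⁺ f [] c _ _ (π↭[] , _ , sat) with refl ← ↭-empty-inv π↭[] = empty c sat
  where
  empty : ∀ c → Satisfies 0 c → [] ∈ jacobiWords f [] c
  empty unconstrained  _ = here refl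
  empty (exactly zero) _ = here refl
jacobiWords⁺ (suc f) (m ∷ R) c (s≤s R≤f) (m<R ∷ incR) (π↭mR , jπ , sat)
  with σ , τ , refl            ← ∈-∃++ (∈-resp-↭ (↭-sym π↭mR) (here refl))
  with m<σ , m<τ               ← Allₚ.++⁻ σ (All-resp-↭ (↭-sym (drop-mid σ [] π↭mR)) m<R)
  with jσ , (2∣ρm , jτ)        ← Jacobi-++-∷⁻ m σ τ m<σ jπ
  with c′ , c⇝c′ , σ-sat       ← Satisfies-suc⁻ c (subst (λ l → Satisfies l c) (lrmin-++-∷ m σ τ m<σ m<τ) sat)
  with T , U , sp , τ↭T , σ↭U  ← ↭-Interleaving R τ σ (↭-trans (++-comm τ σ) (drop-mid σ [] π↭mR))
  with incT , incU             ← Interleaving-AllPairs sp incR =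
  subst (_ ∈_) (sym (jacobiWords-∷ f m R c⇝c′))
    (∈-concatMap⁺ (glueBlock f m c′) (lose (∈-unshuffles⁺ sp) (∈-if⁺ even (∈-glue⁺ m σ∈ τ∈))))
  where
  even : isEven (length T) ≡ true
  even = 2∣⇒isEven (length T) (subst (2 ∣_) (trans (rhoLen-above m τ m<τ) (↭-length τ↭T)) 2∣ρm)
  σ∈ = jacobiWords⁺ f U c′ (ℕP.≤-trans (Interleaving-length≤ʳ sp) R≤f) incU (σ↭U , jσ , σ-sat)
  τ∈ = jacobiWords⁺ f T unconstrained (ℕP.≤-trans (Interleaving-length≤ˡ sp) R≤f) incT (τ↭T , jτ , tt)

mutual
  Unique-jacobiWords : ∀ f S c → length S ≤ f → AllPairs _<_ S → Unique (jacobiWords f S c)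
  Unique-jacobiWords _       []      unconstrained     _         _   = [] ∷ []
  Unique-jacobiWords _       []      (exactly zero)    _         _   = [] ∷ []
  Unique-jacobiWords _       []      (exactly (suc _)) _         _   = []
  Unique-jacobiWords (suc f) (m ∷ R) unconstrained     (s≤s R≤f) inc = Unique-glueAtMin f m R unconstrained R≤f inc
  Unique-jacobiWords (suc f) (m ∷ R) (exactly zero)    _         _   = []
  Unique-jacobiWords (suc f) (m ∷ R) (exactly (suc k)) (s≤s R≤f) inc = Unique-glueAtMin f m R (exactly k) R≤f inc

  -- A word in glueBlock f m c′ (T , U) determines T as the letters of R that follow m in it.
  Unique-glueAtMin : ∀ f m R c′ → length R ≤ f → AllPairs _<_ (m ∷ R) → Unique (glueAtMin f m R c′)
  Unique-glueAtMin f m R c′ R≤f (m<R ∷ incR) =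
    Unique-concatMap (glueBlock f m c′) (λ π → filter (_∈? proj₂ (breakAt m π)) R) proj₁
      (Unique-map-proj₁-unshuffles (AllPairs.map ℕP.<⇒≢ incR)) unique-block (λ TU∈ → tagged TU∈)
    where
    module _ {T U} (TU∈ : (T , U) ∈ unshuffles R) where
      sp = ∈-unshuffles⁻ R TU∈
      T≤f = ℕP.≤-trans (Interleaving-length≤ˡ sp) R≤f
      U≤f = ℕP.≤-trans (Interleaving-length≤ʳ sp) R≤f
      incT = proj₁ (Interleaving-AllPairs sp incR)
      incU = proj₂ (Interleaving-AllPairs sp incR)

      m∉σ : ∀ {σ} → σ ∈ jacobiWords f U c′ → m ∉ σ
      m∉σ σ∈ m∈σ = ℕP.<-irrefl refl (All.lookup m<R (Interleaving-⊆ʳ sp (∈-resp-↭ (proj₁ (jacobiWords⁻ f U c′ U≤f incU σ∈)) m∈σ)))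

      unique-block : Unique (glueBlock f m c′ (T , U))
      unique-block = Unique-if (isEven (length T))
        (Unique-glue m (Unique-jacobiWords f U c′ U≤f incU) (Unique-jacobiWords f T unconstrained T≤f incT) m∉σ)

      tagged : ∀ {π} → π ∈ glueBlock f m c′ (T , U) → filter (_∈? proj₂ (breakAt m π)) R ≡ T
      tagged π∈ with _ , π∈glue ← ∈-if⁻ (isEven (length T)) π∈
                with σ , τ , σ∈ , τ∈ , refl ← ∈-glue⁻ m (jacobiWords f U c′) (jacobiWords f T unconstrained) π∈glue
                with τ↭T , _ ← jacobiWords⁻ f T unconstrained T≤f incT τ∈ = begin
        filter (_∈? proj₂ (breakAt m (σ ++ m ∷ τ))) R
          ≡⟨ cong (λ bs → filter (_∈? proj₂ bs) R) (breakAt-++-∷ m σ τ (m∉σ σ∈)) ⟩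
        filter (_∈? τ) R
          ≡⟨ filter-∈-Interleaving τ (AllPairs.map ℕP.<⇒≢ incR) sp (λ _ → mk⇔ (∈-resp-↭ τ↭T) (∈-resp-↭ (↭-sym τ↭T))) ⟩
        T ∎
        where open ≡-Reasoning

mutual
  length-jacobiWords : ∀ f S c → length S ≤ f → fromℕ (length (jacobiWords f S c)) ≡ labelled (egf c) (length S)
  length-jacobiWords _       []      unconstrained     _         = refl
  length-jacobiWords _       []      (exactly zero)    _         = refl
  length-jacobiWords _       []      (exactly (suc k)) _         = sym (trans (cong (1ℚ *_) (secTanPowT-suc-0 k)) (ℚP.*-zeroʳ 1ℚ))
  length-jacobiWords (suc f) (m ∷ R) unconstrained     (s≤s R≤f) = length-glueAtMin f m R unconstrained⇝ R≤f
  length-jacobiWords (suc f) (m ∷ R) (exactly zero)    _         = sym (ℚP.*-zeroʳ (fromℕ (suc (length R) !)))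
  length-jacobiWords (suc f) (m ∷ R) (exactly (suc k)) (s≤s R≤f) = length-glueAtMin f m R (exactly⇝ k) R≤f

  length-glueAtMin : ∀ {c c′} f m R → c ⇝ c′ → length R ≤ f →
    fromℕ (length (glueAtMin f m R c′)) ≡ labelled (egf c) (suc (length R))
  length-glueAtMin {c} {c′} f m R c⇝c′ R≤f = begin
    fromℕ (length (concatMap (glueBlock f m c′) (unshuffles R)))   ≡⟨ fromℕ-length-concatMap (glueBlock f m c′) (unshuffles R) ⟩
    sumℚ (map (fromℕ ∘ length ∘ glueBlock f m c′) (unshuffles R))  ≡⟨ unshuffles-sum R (fromℕ ∘ length ∘ glueBlock f m c′) F length-block ⟩
    binomialSum (length R) F                                       ≡⟨ labelled-egf-suc c⇝c′ (length R) ⟨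
    labelled (egf c) (suc (length R))                              ∎
    where
    open ≡-Reasoning
    F : ℕ → ℕ → ℚ
    F t u = if isEven t then labelled (egf c′) u * labelled secTan t else 0ℚ

    length-block : ∀ {T U} → Interleaving T U R → fromℕ (length (glueBlock f m c′ (T , U))) ≡ F (length T) (length U)
    length-block {T} {U} sp = fromℕ-length-if (isEven (length T)) (begin
      fromℕ (length (glue m (jacobiWords f U c′) (jacobiWords f T unconstrained)))
        ≡⟨ cong fromℕ (length-glue m (jacobiWords f U c′) (jacobiWords f T unconstrained)) ⟩
      fromℕ (length (jacobiWords f U c′) ℕ.* length (jacobiWords f T unconstrained))
        ≡⟨ fromℕ-* (length (jacobiWords f U c′)) (length (jacobiWords f T unconstrained)) ⟩
      fromℕ (length (jacobiWords f U c′)) * fromℕ (length (jacobiWords f T unconstrained))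
        ≡⟨ cong₂ _*_ (length-jacobiWords f U c′ (ℕP.≤-trans (Interleaving-length≤ʳ sp) R≤f))
                     (length-jacobiWords f T unconstrained (ℕP.≤-trans (Interleaving-length≤ˡ sp) R≤f)) ⟩
      labelled (egf c′) (length U) * labelled secTan (length T)
        ∎)

theorem2p6 : (n k : ℕ) →
    Σ (List (List ℕ)) (λ L →
    Unique L ×
    ((π : List ℕ) → (π ∈ L) ⇔ JacobiLrmin n k π) ×
    (ℤ.+ length L / 1 ≡ (ℤ.+ (n !) / 1) * secTanPowT k n))
theorem2p6 n k =
  jacobiWords n S (exactly k) ,
  Unique-jacobiWords n S (exactly k) S≤n increasing ,
  (λ π → mk⇔ (jacobiWords⁻ n S (exactly k) S≤n increasing) (jacobiWords⁺ n S (exactly k) S≤n increasing)) ,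
  subst (λ l → fromℕ (length (jacobiWords n S (exactly k))) ≡ labelled (secTanPowT k) l) length-S
        (length-jacobiWords n S (exactly k) S≤n)
  where
  S = oneTo n
  length-S : length S ≡ n
  length-S = trans (LP.length-map suc (upTo n)) (LP.length-upTo n)
  S≤n = ℕP.≤-reflexive length-S
  increasing : AllPairs _<_ S
  increasing = AllPairsₚ.map⁺ (AllPairsₚ.applyUpTo⁺₁ (λ i → i) n (λ i<j _ → s≤s i<j))
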